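{- Let $r\geq 2$, $t\geq 1$ with $t\mid n$, and $\alpha\in(0,1]$ with $\alpha n/t$ an integer. Let $S\in\mathbb{Z}_r^n\setminus\{0^n\}$ be such that for each $j\in\{1,\ldots,r-1\}$ the number $k_j:=\frac1t|\{i\in[n]:S_i=j\}|$ is an integer, and let $k=\sum_{j=1}^{r-1}k_j$. For an $\alpha$-partial $t$-hypermatching $M$, let $\Delta(M)$ be the set of nonzero $S'\in\mathbb{Z}_r^n$ that are constant on each hyperedge of $M$ and vanish on every vertex not covered by $M$. Then \[ \Pr_{M\sim\mathcal{M}^\alpha_{t,n}}[S\in\Delta(M)]=\frac{\binom{\alpha n/t}{k}}{\binom{n}{kt}}\cdot\frac{k!}{(kt)!}\prod_{j=1}^{r-1}\frac{(k_jt)!}{k_j!}. \]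
   Context: $\mathcal{M}^\alpha_{t,n}$ is the set of $\alpha$-partial $t$-hypermatchings on $[n]$ (sequences of $\alpha n/t$ pairwise disjoint hyperedges, each of $t$ distinct elements of $[n]$), and $M\sim\mathcal{M}^\alpha_{t,n}$ means $M$ is uniformly random. $\binom{a}{b}=0$ if $b>a$. -}

module Defs where

open import Data.Bool using (Bool; true; false; _∧_; not; if_then_else_)
open import Data.Nat using (ℕ; zero; suc; _+_; _*_; _≡ᵇ_)
open import Data.Fin using (Fin; toℕ; _≟_)
open import Data.Fin.Subset using (Subset; ∣_∣)
open import Data.List using (List; []; _∷_; [_]; concatMap; map; length; filterᵇ; allFin; foldr)
open import Data.Bool.ListAction using (all; any)
open import Data.Vec using (Vec; lookup) renaming ([] to []ᵥ; _∷_ to _∷ᵥ_)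
open import Relation.Nullary.Decidable using (⌊_⌋)

countᵇ : {A : Set} → (A → Bool) → List A → ℕ
countᵇ p xs = length (filterᵇ p xs)

allVecs : {A : Set} → List A → (m : ℕ) → List (Vec A m)
allVecs xs zero = [ []ᵥ ]
allVecs xs (suc m) = concatMap (λ x → map (x ∷ᵥ_) (allVecs xs m)) xs

allSubsets : (n : ℕ) → List (Subset n)
allSubsets zero = [ []ᵥ ]
allSubsets (suc n) = concatMap (λ v → (true ∷ᵥ v) ∷ (false ∷ᵥ v) ∷ []) (allSubsets n)

isHypermatching : (t n m : ℕ) → Vec (Subset n) m → Bool
isHypermatching t n m M =
  all (λ a → ∣ lookup M a ∣ ≡ᵇ t) (allFin m) ∧
  all (λ a → all (λ b → ⌊ a ≟ b ⌋ ∨' all (λ i → not (lookup (lookup M a) i ∧ lookup (lookup M b) i)) (allFin n)) (allFin m)) (allFin m)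
  where
  _∨'_ : Bool → Bool → Bool
  true ∨' _ = true
  false ∨' y = y

-- the list of all m-edge t-hypermatchings on [n]  (the set M^α_{t,n} with α = m t / n)
hypermatchings : (t n m : ℕ) → List (Vec (Subset n) m)
hypermatchings t n m = filterᵇ (isHypermatching t n m) (allVecs (allSubsets n) m)

isZeroᶠ : {r : ℕ} → Fin (suc r) → Bool
isZeroᶠ Fin.zero = true
isZeroᶠ (Fin.suc _) = false

inΔ : {r n m : ℕ} → Vec (Fin (suc r)) n → Vec (Subset n) m → Bool
inΔ {r} {n} {m} S M =
  any (λ i → not (isZeroᶠ (lookup S i))) (allFin n) ∧
  all (λ a → all (λ i → all (λ i' →
        not (lookup (lookup M a) i ∧ lookup (lookup M a) i') ∨'' ⌊ lookup S i ≟ lookup S i' ⌋)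
        (allFin n)) (allFin n)) (allFin m) ∧
  all (λ i → any (λ a → lookup (lookup M a) i) (allFin m) ∨'' isZeroᶠ (lookup S i)) (allFin n)
  where
  _∨''_ : Bool → Bool → Bool
  true ∨'' _ = true
  false ∨'' y = y

occ : {r n : ℕ} → Vec (Fin r) n → Fin r → ℕ
occ {r} {n} S j = countᵇ (λ i → ⌊ lookup S i ≟ j ⌋) (allFin n)

nonzeroFin : (r : ℕ) → List (Fin (suc r))
nonzeroFin r = map Fin.suc (allFin r)

sumNZ : {r : ℕ} → (Fin (suc r) → ℕ) → ℕ
sumNZ {r} f = foldr (λ j acc → f j + acc) 0 (nonzeroFin r)

prodNZ : {r : ℕ} → (Fin (suc r) → ℕ) → ℕ
prodNZ {r} f = foldr (λ j acc → f j * acc) 1 (nonzeroFin r)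

-- Choose the hyperedges one at a time.  An ordered sequence of m pairwise
-- disjoint t-subsets of a u-element set can be chosen in packings u m ways, where
-- packings u (m + 1) = C(u,t) · packings (u − t) m, so packings u m · (t!)^m · (u − mt)! = u!.
-- The matchings M with S ∈ Δ(M) are exactly those whose hyperedges are monochromatic and
-- cover every vertex of nonzero colour.  Choosing the first hyperedge inside one colour class
-- gives a recursion on the vector of class sizes (z, k₁t, …, k_{r−1}t), whose solution is
--   C(m,K) · K!/∏ kⱼ! · ∏ packings (kⱼt) kⱼ · packings z (m − K),      K = Σ kⱼ:
-- place the K coloured hyperedges among the m positions, partition each colour class into
-- ordered t-sets, and fill the remaining positions from the z vertices of colour zero.
-- Cross-multiplying the factorials turns this into the stated identity.

module Submission where

open import Defs
import Data.List
open import Data.Nat using (ℕ; suc; _*_; _≤_; _!)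
open import Data.Nat.Divisibility using (_∣_)
open import Data.Nat.Combinatorics using (_C_)
open import Data.Fin using (Fin; zero; toℕ)
open import Data.Vec using (Vec; replicate)
open import Relation.Binary.PropositionalEquality using (_≡_; _≢_)

open import Algebra.Bundles using (CommutativeMonoid)
open import Data.Bool using (Bool; true; false; _∧_; not; T; T?)
open import Data.Bool.Properties using (T-∧; T-≡; T-not-≡; ∧-zeroʳ)
open import Data.Bool.ListAction using (all; any; and)
open import Data.Empty using (⊥-elim)
open import Data.Fin using (suc; punchIn; _≟_)
open import Data.Fin.Properties using (punchInᵢ≢i; ¬∀⟶∃¬; suc-injective)
open import Data.Fin.Subset using (Subset; Side; inside; outside; _∈_; _∉_; _⊆_; _∩_; _─_; ⊤; ∣_∣; ⁅_⁆; Nonempty; Empty)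
open import Data.Fin.Subset.Properties
  using (_⊆?_; _∈?_; nonempty?; ∈⊤; ⊆⊤; drop-∷-⊆; ∩-identityˡ; ∩-identityʳ; ∣⁅x⁆∣≡1; ∣⊤∣≡n; ∣⊥∣≡0; p⊆q⇒∣p∣≤∣q∣;
         x∈⁅y⁆⇒x≡y; Empty-unique; p∩q⊆p; p∩q⊆q; x∈p∩q⁺; x∈p∩q⁻; p─q⊆p; x∈p∧x∉q⇒x∈p─q)
open import Data.List using (List; []; _∷_; _++_; map; concatMap; filterᵇ; foldr; allFin)
open import Data.List.Properties using (map-cong; map-tabulate)
import Data.List.Relation.Unary.All.Properties as All
import Data.List.Relation.Unary.Any.Properties as Any
open import Data.Nat using (zero; _≡ᵇ_; _+_; _∸_; _<_; _^_; _≤?_; >-nonZero)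
open import Data.Nat.Combinatorics using (nCk≡n!/k![n-k]!; k![n∸k]!∣n!; k>n⇒nCk≡0; nCk+nC[k+1]≡[n+1]C[k+1])
open import Data.Nat.DivMod using (_/_; m/n*n≡m)
open import Data.Nat.Properties hiding (_≟_; suc-injective)
open import Data.Nat.Tactic.RingSolver using (solve-∀)
open import Data.Product using (∃; _×_; _,_; proj₁; proj₂; uncurry)
open import Data.Sum using (_⊎_; inj₁; inj₂)
open import Data.Vec using (lookup; tabulate; _[_]=_; here; there) renaming ([] to []ᵥ; _∷_ to _∷ᵥ_)
open import Data.Vec.Properties using ([]=⇒lookup; lookup⇒[]=; lookup∘tabulate)
import Data.Vec.Functional as Vector
open import Data.Vec.Functional using (Vector; removeAt; updateAt) renaming (_∷_ to _∷ᶠ_)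
open import Data.Vec.Functional.Properties using (updateAt-updates; updateAt-minimal)
open import Function using (_∘_; id; flip; _⇔_; mk⇔; Equivalence; case_of_)
open import Relation.Binary.Bundles using (Setoid)
import Relation.Binary.Reasoning.Setoid
import Algebra.Properties.CommutativeMonoid.Sum
open import Relation.Binary.PropositionalEquality using (_≗_; refl; sym; trans; cong; cong₂; subst; subst₂; module ≡-Reasoning)
open import Relation.Nullary using (¬_; Dec; does; yes; no)
open import Relation.Nullary.Decidable using (⌊_⌋; toWitness; fromWitness)

open import Algebra.Properties.Semiring.Sum +-*-semiring
  using (sum; sum-cong-≗; sum-remove; ∑-distrib-+; *-distribʳ-sum)
open import Algebra.Properties.CommutativeMonoid.Sum *-1-commutativeMonoid
  using () renaming (sum to product)

open Equivalence using (to; from)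

⟦_⟧ : Bool → ℕ
⟦ true ⟧ = 1
⟦ false ⟧ = 0

⟦∧⟧ : ∀ x y → ⟦ x ∧ y ⟧ ≡ ⟦ x ⟧ * ⟦ y ⟧
⟦∧⟧ true y = sym (+-identityʳ ⟦ y ⟧)
⟦∧⟧ false y = refl

⟦⟧*-cong : ∀ x {v w} → (T x → v ≡ w) → ⟦ x ⟧ * v ≡ ⟦ x ⟧ * w
⟦⟧*-cong true v≡w = cong (1 *_) (v≡w _)
⟦⟧*-cong false v≡w = refl

T⇒⟦⟧≡1 : ∀ {x} → T x → ⟦ x ⟧ ≡ 1
T⇒⟦⟧≡1 {true} _ = refl

¬T⇒⟦⟧≡0 : ∀ {x} → ¬ T x → ⟦ x ⟧ ≡ 0
¬T⇒⟦⟧≡0 {true} ¬x = ⊥-elim (¬x _)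
¬T⇒⟦⟧≡0 {false} _ = refl

T-⇔⇒≡ : ∀ {x y} → T x ⇔ T y → x ≡ y
T-⇔⇒≡ {true} {true} _ = refl
T-⇔⇒≡ {true} {false} x⇔y = ⊥-elim (to x⇔y _)
T-⇔⇒≡ {false} {true} x⇔y = ⊥-elim (from x⇔y _)
T-⇔⇒≡ {false} {false} _ = refl

T-does : ∀ {p} {P : Set p} (d : Dec P) → T (does d) ⇔ P
T-does (yes p) = mk⇔ (λ _ → p) (λ _ → _)
T-does (no ¬p) = mk⇔ (λ ()) ¬p

T-not : ∀ {x} → T (not x) ⇔ (¬ T x)
T-not {true} = mk⇔ (λ ()) (λ ¬x → ¬x _)
T-not {false} = mk⇔ (λ _ ()) (λ _ → _)

∧≡true⇔ : ∀ {x y} → x ∧ y ≡ true ⇔ (x ≡ true × y ≡ true)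
∧≡true⇔ {true} = mk⇔ (refl ,_) proj₂
∧≡true⇔ {false} = mk⇔ (λ ()) (λ ())

∧≡false : ∀ {x y} → x ∧ y ≡ false → x ≡ false ⊎ y ≡ false
∧≡false {true} y≡false = inj₂ y≡false
∧≡false {false} _ = inj₁ refl

module _ {n : ℕ} {p : Fin n → Bool} where

  T-allFin : T (all p (allFin n)) ⇔ (∀ i → T (p i))
  T-allFin = mk⇔ (All.tabulate⁻ ∘ All.all⁺ p (allFin n)) (All.all⁻ p ∘ All.tabulate⁺)

  T-anyFin : T (any p (allFin n)) ⇔ ∃ λ i → T (p i)
  T-anyFin = mk⇔ (Any.tabulate⁻ ∘ Any.any⁻ p (allFin n)) (λ (i , pi) → Any.any⁺ p (Any.tabulate⁺ i pi))

  all-allFin⇔ : all p (allFin n) ≡ true ⇔ (∀ i → p i ≡ true)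
  all-allFin⇔ = mk⇔ (λ all≡ i → to T-≡ (to T-allFin (from T-≡ all≡) i)) (λ p≡ → to T-≡ (from T-allFin (from T-≡ ∘ p≡)))

  all-allFin-false : all p (allFin n) ≡ false → ∃ λ i → p i ≡ false
  all-allFin-false all≡false =
    let (i , ¬pi) = ¬∀⟶∃¬ n (T ∘ p) (T? ∘ p) (λ all-p → subst T all≡false (from T-allFin all-p))
    in i , to T-not-≡ (from T-not ¬pi)

  any-allFin⇔ : any p (allFin n) ≡ true ⇔ ∃ λ i → p i ≡ true
  any-allFin⇔ = mk⇔ (λ any≡ → let (i , pi) = to T-anyFin (from T-≡ any≡) in i , to T-≡ pi)
                    (λ (i , pi) → to T-≡ (from T-anyFin (i , from T-≡ pi)))

-- Sums

∑ˡ : {A : Set} → (A → ℕ) → List A → ℕ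
∑ˡ w [] = 0
∑ˡ w (x ∷ xs) = w x + ∑ˡ w xs

module _ {A : Set} where

  countᵇ≡∑ˡ : (p : A → Bool) (xs : List A) → countᵇ p xs ≡ ∑ˡ (⟦_⟧ ∘ p) xs
  countᵇ≡∑ˡ p [] = refl
  countᵇ≡∑ˡ p (x ∷ xs) with p x
  ... | true = cong suc (countᵇ≡∑ˡ p xs)
  ... | false = countᵇ≡∑ˡ p xs

  countᵇ-filterᵇ : (p q : A → Bool) (xs : List A) → countᵇ q (filterᵇ p xs) ≡ countᵇ (λ x → p x ∧ q x) xs
  countᵇ-filterᵇ p q [] = refl
  countᵇ-filterᵇ p q (x ∷ xs) with p x
  ... | false = countᵇ-filterᵇ p q xs
  ... | true with q x
  ...   | true = cong suc (countᵇ-filterᵇ p q xs)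
  ...   | false = countᵇ-filterᵇ p q xs

  ∑ˡ-cong : {v w : A → ℕ} → (∀ x → v x ≡ w x) → (xs : List A) → ∑ˡ v xs ≡ ∑ˡ w xs
  ∑ˡ-cong e [] = refl
  ∑ˡ-cong e (x ∷ xs) = cong₂ _+_ (e x) (∑ˡ-cong e xs)

  ∑ˡ-++ : (w : A → ℕ) (xs ys : List A) → ∑ˡ w (xs ++ ys) ≡ ∑ˡ w xs + ∑ˡ w ys
  ∑ˡ-++ w [] ys = refl
  ∑ˡ-++ w (x ∷ xs) ys = trans (cong (w x +_) (∑ˡ-++ w xs ys)) (sym (+-assoc (w x) _ _))

  ∑ˡ-+ : (v w : A → ℕ) (xs : List A) → ∑ˡ (λ x → v x + w x) xs ≡ ∑ˡ v xs + ∑ˡ w xs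
  ∑ˡ-+ v w [] = refl
  ∑ˡ-+ v w (x ∷ xs) = trans (cong (v x + w x +_) (∑ˡ-+ v w xs)) (+-exchange (v x) (w x) _ _)
    where
    +-exchange : ∀ a b c d → a + b + (c + d) ≡ a + c + (b + d)
    +-exchange = solve-∀

  ∑ˡ-*ˡ : (c : ℕ) (w : A → ℕ) (xs : List A) → ∑ˡ (λ x → c * w x) xs ≡ c * ∑ˡ w xs
  ∑ˡ-*ˡ c w [] = sym (*-zeroʳ c)
  ∑ˡ-*ˡ c w (x ∷ xs) = trans (cong (c * w x +_) (∑ˡ-*ˡ c w xs)) (sym (*-distribˡ-+ c (w x) _))

  ∑ˡ-*ʳ : (c : ℕ) (w : A → ℕ) (xs : List A) → ∑ˡ (λ x → w x * c) xs ≡ ∑ˡ w xs * c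
  ∑ˡ-*ʳ c w xs = trans (∑ˡ-cong (λ x → *-comm (w x) c) xs) (trans (∑ˡ-*ˡ c w xs) (*-comm c _))

  ∑ˡ-⟦∧⟧ : (b : Bool) (p : A → Bool) (xs : List A) → ∑ˡ (λ x → ⟦ b ∧ p x ⟧) xs ≡ ⟦ b ⟧ * ∑ˡ (⟦_⟧ ∘ p) xs
  ∑ˡ-⟦∧⟧ b p xs = trans (∑ˡ-cong (⟦∧⟧ b ∘ p) xs) (∑ˡ-*ˡ ⟦ b ⟧ (⟦_⟧ ∘ p) xs)

module _ {A B : Set} where

  ∑ˡ-map : (w : B → ℕ) (f : A → B) (xs : List A) → ∑ˡ w (map f xs) ≡ ∑ˡ (w ∘ f) xs
  ∑ˡ-map w f [] = refl
  ∑ˡ-map w f (x ∷ xs) = cong (w (f x) +_) (∑ˡ-map w f xs)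

  ∑ˡ-concatMap : (w : B → ℕ) (f : A → List B) (xs : List A) → ∑ˡ w (concatMap f xs) ≡ ∑ˡ (∑ˡ w ∘ f) xs
  ∑ˡ-concatMap w f [] = refl
  ∑ˡ-concatMap w f (x ∷ xs) = trans (∑ˡ-++ w (f x) _) (cong (∑ˡ w (f x) +_) (∑ˡ-concatMap w f xs))

∑ˡ-allVecs : {A : Set} (m : ℕ) (w : Vec A (suc m) → ℕ) (xs : List A) →
  ∑ˡ w (allVecs xs (suc m)) ≡ ∑ˡ (λ x → ∑ˡ (λ M → w (x ∷ᵥ M)) (allVecs xs m)) xs
∑ˡ-allVecs m w xs = trans (∑ˡ-concatMap w _ xs) (∑ˡ-cong (λ x → ∑ˡ-map w (x ∷ᵥ_) (allVecs xs m)) xs)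

module _ {c ℓ} (M : CommutativeMonoid c ℓ) where
  open CommutativeMonoid M using (Carrier; _≈_; _∙_; ε; ∙-cong; ∙-congˡ; assoc; setoid)
  open Setoid setoid using () renaming (sym to ≈-sym; trans to ≈-trans)
  private module ΣM = Algebra.Properties.CommutativeMonoid.Sum M
  open Relation.Binary.Reasoning.Setoid setoid

  sum-except : ∀ {n} {u v : Vector Carrier n} (j : Fin n) {x : Carrier} →
    u j ≈ x ∙ v j → (∀ i → i ≢ j → u i ≈ v i) → ΣM.sum u ≈ x ∙ ΣM.sum v
  sum-except {suc n} {u} {v} j {x} uj≈xvj agree = begin
    ΣM.sum u                            ≈⟨ ΣM.sum-remove {i = j} u ⟩
    u j ∙ ΣM.sum (removeAt u j)         ≈⟨ ∙-cong uj≈xvj (ΣM.sum-cong-≋ (λ i → agree (punchIn j i) (punchInᵢ≢i j i))) ⟩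
    (x ∙ v j) ∙ ΣM.sum (removeAt v j)   ≈⟨ assoc x (v j) _ ⟩
    x ∙ (v j ∙ ΣM.sum (removeAt v j))   ≈⟨ ∙-congˡ (≈-sym (ΣM.sum-remove {i = j} v)) ⟩
    x ∙ ΣM.sum v                        ∎

  sum-ε : ∀ {n} {u : Vector Carrier n} → (∀ i → u i ≈ ε) → ΣM.sum u ≈ ε
  sum-ε {n} u≈ε = ≈-trans (ΣM.sum-cong-≋ u≈ε) (ΣM.sum-replicate-zero n)

sum-zero : ∀ {n} {u : Vector ℕ n} → (∀ i → u i ≡ 0) → sum u ≡ 0
sum-zero = sum-ε +-0-commutativeMonoid

product-one : ∀ {n} {u : Vector ℕ n} → (∀ i → u i ≡ 1) → product u ≡ 1
product-one = sum-ε *-1-commutativeMonoid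

≤-sum : ∀ {n} (u : Vector ℕ n) (j : Fin n) → u j ≤ sum u
≤-sum {suc n} u j = ≤-trans (m≤m+n (u j) _) (≤-reflexive (sym (sum-remove {i = j} u)))

sum-⟦⟧-unique : ∀ {n} (p : Fin n → Bool) → (∀ {i j} → T (p i) → T (p j) → i ≡ j) →
  sum (λ j → ⟦ p j ⟧) ≡ ⟦ any p (allFin n) ⟧
sum-⟦⟧-unique {suc n} p unique with T? (any p (allFin (suc n)))
... | yes some = let (j , pj) = to (T-anyFin {p = p}) some in begin
    sum (λ i → ⟦ p i ⟧)   ≡⟨ sum-except +-0-commutativeMonoid j (T⇒⟦⟧≡1 pj) (λ i i≢j → ¬T⇒⟦⟧≡0 (i≢j ∘ flip unique pj)) ⟩
    1 + sum {n} (λ _ → 0) ≡⟨ cong suc (sum-zero {n} (λ _ → refl)) ⟩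
    1                     ≡⟨ T⇒⟦⟧≡1 some ⟨
    ⟦ any p (allFin (suc n)) ⟧ ∎
  where open ≡-Reasoning
... | no none = trans (sum-zero (λ i → ¬T⇒⟦⟧≡0 (λ pi → none (from (T-anyFin {p = p}) (i , pi))))) (sym (¬T⇒⟦⟧≡0 none))
sum-⟦⟧-unique {zero} p unique = refl

∑ˡ-sum-comm : ∀ {A : Set} {n} (w : A → Fin n → ℕ) (xs : List A) →
  ∑ˡ (λ x → sum (w x)) xs ≡ sum (λ j → ∑ˡ (λ x → w x j) xs)
∑ˡ-sum-comm {n = n} w [] = sym (sum-zero {n} (λ _ → refl))
∑ˡ-sum-comm w (x ∷ xs) = trans (cong (sum (w x) +_) (∑ˡ-sum-comm w xs)) (sym (∑-distrib-+ (w x) _))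

module _ {A : Set} (_∙_ : A → A → A) (ε : A) where

  foldr-tabulate : ∀ {B : Set} {n} (f : B → A) (g : Fin n → B) →
    foldr (λ j acc → f j ∙ acc) ε (Data.List.tabulate g) ≡ Vector.foldr _∙_ ε (f ∘ g)
  foldr-tabulate {n = zero} f g = refl
  foldr-tabulate {n = suc n} f g = cong (f (g zero) ∙_) (foldr-tabulate f (g ∘ suc))

sumNZ≡sum : ∀ {r} (f : Fin (suc r) → ℕ) → sumNZ f ≡ sum (f ∘ suc)
sumNZ≡sum {r} f = trans (cong (foldr (λ j acc → f j + acc) 0) (map-tabulate {n = r} id Fin.suc)) (foldr-tabulate _+_ 0 f suc)

prodNZ≡product : ∀ {r} (f : Fin (suc r) → ℕ) → prodNZ f ≡ product (f ∘ suc)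
prodNZ≡product {r} f = trans (cong (foldr (λ j acc → f j * acc) 1) (map-tabulate {n = r} id Fin.suc)) (foldr-tabulate _*_ 1 f suc)

-- Binomial coefficients

nCk*k!*[n∸k]!≡n! : ∀ {n k} → k ≤ n → (n C k) * k ! * (n ∸ k) ! ≡ n !
nCk*k!*[n∸k]!≡n! {n} {k} k≤n = begin
  (n C k) * k ! * (n ∸ k) !                     ≡⟨ *-assoc (n C k) (k !) _ ⟩
  (n C k) * (k ! * (n ∸ k) !)                   ≡⟨ cong (_* (k ! * (n ∸ k) !)) (nCk≡n!/k![n-k]! k≤n) ⟩
  n ! / (k ! * (n ∸ k) !) * (k ! * (n ∸ k) !)   ≡⟨ m/n*n≡m (k![n∸k]!∣n! k≤n) ⟩
  n !                                           ∎
  where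
  open ≡-Reasoning
  instance _ = k !* (n ∸ k) !≢0

mCk*k!+k*mC[k∸1]*[k∸1]!≡[1+m]Ck*k! : ∀ m k → (m C k) * k ! + k * ((m C (k ∸ 1)) * (k ∸ 1) !) ≡ (suc m C k) * k !
mCk*k!+k*mC[k∸1]*[k∸1]!≡[1+m]Ck*k! m zero = refl
mCk*k!+k*mC[k∸1]*[k∸1]!≡[1+m]Ck*k! m (suc k) = begin
  (m C suc k) * suc k ! + suc k * ((m C k) * k !)   ≡⟨ regroup (m C suc k) (m C k) (k !) k ⟩
  ((m C k) + (m C suc k)) * suc k !                 ≡⟨ cong (_* suc k !) (nCk+nC[k+1]≡[n+1]C[k+1] m k) ⟩
  (suc m C suc k) * suc k !                         ∎
  where
  open ≡-Reasoning
  regroup : ∀ a b f k → a * (suc k * f) + suc k * (b * f) ≡ (b + a) * (suc k * f)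
  regroup = solve-∀

nCk*-cong : ∀ {n k x y} → (k ≤ n → x ≡ y) → (n C k) * x ≡ (n C k) * y
nCk*-cong {n} {k} x≡y with k ≤? n
... | yes k≤n = cong ((n C k) *_) (x≡y k≤n)
... | no k≰n rewrite k>n⇒nCk≡0 (≰⇒> k≰n) = refl

-- Subsets

module _ {n : ℕ} where

  ∈⇔lookup : {p : Subset n} {i : Fin n} → i ∈ p ⇔ lookup p i ≡ inside
  ∈⇔lookup {p} {i} = mk⇔ []=⇒lookup (lookup⇒[]= i p)

  ∣∷∣ : (b : Side) (p : Subset n) → ∣ b ∷ᵥ p ∣ ≡ ⟦ b ⟧ + ∣ p ∣
  ∣∷∣ inside p = refl
  ∣∷∣ outside p = refl

  ∣p∣≡0⇒Empty : {p : Subset n} → ∣ p ∣ ≡ 0 → Empty p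
  ∣p∣≡0⇒Empty {p} ∣p∣≡0 (i , i∈p) = 1+n≢0 {0} (n≤0⇒n≡0 (begin
    1           ≡⟨ ∣⁅x⁆∣≡1 i ⟨
    ∣ ⁅ i ⁆ ∣    ≤⟨ p⊆q⇒∣p∣≤∣q∣ (λ x∈⁅i⁆ → subst (_∈ p) (sym (x∈⁅y⁆⇒x≡y i x∈⁅i⁆)) i∈p) ⟩
    ∣ p ∣        ≡⟨ ∣p∣≡0 ⟩
    0           ∎))
    where open ≤-Reasoning

  Empty⇒∣p∣≡0 : {p : Subset n} → Empty p → ∣ p ∣ ≡ 0
  Empty⇒∣p∣≡0 empty = trans (cong ∣_∣ (Empty-unique empty)) (∣⊥∣≡0 n)

  0<∣p∣⇒Nonempty : {p : Subset n} → 0 < ∣ p ∣ → Nonempty p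
  0<∣p∣⇒Nonempty {p} 0<∣p∣ with nonempty? p
  ... | yes nonempty = nonempty
  ... | no empty = ⊥-elim (<⇒≢ 0<∣p∣ (sym (Empty⇒∣p∣≡0 empty)))

  ⊆-∩ : {p q r : Subset n} → r ⊆ p ∩ q ⇔ (r ⊆ p × r ⊆ q)
  ⊆-∩ {p} {q} {r} = mk⇔ split join
    where
    split : r ⊆ p ∩ q → r ⊆ p × r ⊆ q
    split r⊆p∩q = p∩q⊆p p q ∘ r⊆p∩q , p∩q⊆q p q ∘ r⊆p∩q
    join : r ⊆ p × r ⊆ q → r ⊆ p ∩ q
    join (r⊆p , r⊆q) x∈r = x∈p∩q⁺ (r⊆p x∈r , r⊆q x∈r)

  ∣x∩q∣≡0 : {x p q : Subset n} → x ⊆ p → Empty (p ∩ q) → ∣ x ∩ q ∣ ≡ 0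
  ∣x∩q∣≡0 {x} {p} {q} x⊆p empty = Empty⇒∣p∣≡0 (λ (i , i∈x∩q) →
    let (i∈x , i∈q) = x∈p∩q⁻ x q i∈x∩q in empty (i , x∈p∩q⁺ (x⊆p i∈x , i∈q)))

p⊆q⇒p∩q≡p : ∀ {n} (p q : Subset n) → p ⊆ q → p ∩ q ≡ p
p⊆q⇒p∩q≡p []ᵥ []ᵥ _ = refl
p⊆q⇒p∩q≡p (outside ∷ᵥ p) (y ∷ᵥ q) p⊆q = cong (outside ∷ᵥ_) (p⊆q⇒p∩q≡p p q (drop-∷-⊆ p⊆q))
p⊆q⇒p∩q≡p (inside ∷ᵥ p) (y ∷ᵥ q) p⊆q with p⊆q here
... | here = cong (inside ∷ᵥ_) (p⊆q⇒p∩q≡p p q (drop-∷-⊆ p⊆q))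

∣p─q∩r∣+∣q∩r∣≡∣p∩r∣ : ∀ {n} (p q r : Subset n) → q ⊆ p → ∣ (p ─ q) ∩ r ∣ + ∣ q ∩ r ∣ ≡ ∣ p ∩ r ∣
∣p─q∩r∣+∣q∩r∣≡∣p∩r∣ []ᵥ []ᵥ []ᵥ _ = refl
∣p─q∩r∣+∣q∩r∣≡∣p∩r∣ (x ∷ᵥ p) (outside ∷ᵥ q) (z ∷ᵥ r) q⊆p = begin
  ∣ (x ∧ z) ∷ᵥ ((p ─ q) ∩ r) ∣ + ∣ q ∩ r ∣        ≡⟨ cong (_+ ∣ q ∩ r ∣) (∣∷∣ (x ∧ z) ((p ─ q) ∩ r)) ⟩
  ⟦ x ∧ z ⟧ + ∣ (p ─ q) ∩ r ∣ + ∣ q ∩ r ∣         ≡⟨ +-assoc ⟦ x ∧ z ⟧ _ _ ⟩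
  ⟦ x ∧ z ⟧ + (∣ (p ─ q) ∩ r ∣ + ∣ q ∩ r ∣)       ≡⟨ cong (⟦ x ∧ z ⟧ +_) (∣p─q∩r∣+∣q∩r∣≡∣p∩r∣ p q r (drop-∷-⊆ q⊆p)) ⟩
  ⟦ x ∧ z ⟧ + ∣ p ∩ r ∣                           ≡⟨ ∣∷∣ (x ∧ z) (p ∩ r) ⟨
  ∣ (x ∧ z) ∷ᵥ (p ∩ r) ∣                          ∎
  where open ≡-Reasoning
∣p─q∩r∣+∣q∩r∣≡∣p∩r∣ (x ∷ᵥ p) (inside ∷ᵥ q) (z ∷ᵥ r) q⊆p with q⊆p here
∣p─q∩r∣+∣q∩r∣≡∣p∩r∣ (inside ∷ᵥ p) (inside ∷ᵥ q) (inside ∷ᵥ r) q⊆p | here =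
  trans (+-suc _ _) (cong suc (∣p─q∩r∣+∣q∩r∣≡∣p∩r∣ p q r (drop-∷-⊆ q⊆p)))
∣p─q∩r∣+∣q∩r∣≡∣p∩r∣ (inside ∷ᵥ p) (inside ∷ᵥ q) (outside ∷ᵥ r) q⊆p | here =
  ∣p─q∩r∣+∣q∩r∣≡∣p∩r∣ p q r (drop-∷-⊆ q⊆p)

∣p─q∩r∣≡∣p∩r∣∸∣q∩r∣ : ∀ {n} (p q r : Subset n) → q ⊆ p → ∣ (p ─ q) ∩ r ∣ ≡ ∣ p ∩ r ∣ ∸ ∣ q ∩ r ∣
∣p─q∩r∣≡∣p∩r∣∸∣q∩r∣ p q r q⊆p =
  trans (sym (m+n∸n≡m _ ∣ q ∩ r ∣)) (cong (_∸ ∣ q ∩ r ∣) (∣p─q∩r∣+∣q∩r∣≡∣p∩r∣ p q r q⊆p))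

∣p─q∣≡∣p∣∸∣q∣ : ∀ {n} (p q : Subset n) → q ⊆ p → ∣ p ─ q ∣ ≡ ∣ p ∣ ∸ ∣ q ∣
∣p─q∣≡∣p∣∸∣q∣ p q q⊆p = begin
  ∣ p ─ q ∣                    ≡⟨ cong ∣_∣ (∩-identityʳ (p ─ q)) ⟨
  ∣ (p ─ q) ∩ ⊤ ∣              ≡⟨ ∣p─q∩r∣≡∣p∩r∣∸∣q∩r∣ p q ⊤ q⊆p ⟩
  ∣ p ∩ ⊤ ∣ ∸ ∣ q ∩ ⊤ ∣        ≡⟨ cong₂ (λ p′ q′ → ∣ p′ ∣ ∸ ∣ q′ ∣) (∩-identityʳ p) (∩-identityʳ q) ⟩
  ∣ p ∣ ∸ ∣ q ∣                ∎
  where open ≡-Reasoning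

x∈p─q⇒x∉q : ∀ {n} (p q : Subset n) {i} → i ∈ p ─ q → i ∉ q
x∈p─q⇒x∉q (x ∷ᵥ p) (inside ∷ᵥ q) () here
x∈p─q⇒x∉q (x ∷ᵥ p) (y ∷ᵥ q) (there i∈p─q) (there i∈q) = x∈p─q⇒x∉q p q i∈p─q i∈q

chooseᵇ : ∀ {n} → ℕ → Subset n → Subset n → Bool
chooseᵇ t U x = (∣ x ∣ ≡ᵇ t) ∧ does (x ⊆? U)

chooseᵇ⇔ : ∀ {n t} {U x : Subset n} → T (chooseᵇ t U x) ⇔ (∣ x ∣ ≡ t × x ⊆ U)
chooseᵇ⇔ {t = t} {U} {x} = mk⇔ sound complete
  where
  sound : T (chooseᵇ t U x) → ∣ x ∣ ≡ t × x ⊆ U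
  sound h = let (size , sub) = to T-∧ h; x⊆U = to (T-does (x ⊆? U)) sub in ≡ᵇ⇒≡ ∣ x ∣ t size , x⊆U
  complete : ∣ x ∣ ≡ t × x ⊆ U → T (chooseᵇ t U x)
  complete (size , x⊆U) = from T-∧ (≡⇒≡ᵇ ∣ x ∣ t size , from (T-does (x ⊆? U)) x⊆U)

∑-chooseᵇ : ∀ {n} (t : ℕ) (U : Subset n) → ∑ˡ (⟦_⟧ ∘ chooseᵇ t U) (allSubsets n) ≡ ∣ U ∣ C t
∑-chooseᵇ {zero} zero []ᵥ = refl
∑-chooseᵇ {zero} (suc t) []ᵥ = refl
∑-chooseᵇ {suc n} t (u ∷ᵥ U) = trans (∑ˡ-concatMap (⟦_⟧ ∘ chooseᵇ t (u ∷ᵥ U)) _ (allSubsets n)) (byHead u t)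
  where
  byHead : ∀ u t → ∑ˡ (λ v → ⟦ chooseᵇ t (u ∷ᵥ U) (inside ∷ᵥ v) ⟧ + (⟦ chooseᵇ t (u ∷ᵥ U) (outside ∷ᵥ v) ⟧ + 0)) (allSubsets n)
                   ≡ ∣ u ∷ᵥ U ∣ C t
  byHead inside zero = trans (∑ˡ-cong (λ v → +-identityʳ _) (allSubsets n)) (∑-chooseᵇ zero U)
  byHead inside (suc t) = begin
    ∑ˡ (λ v → ⟦ chooseᵇ t U v ⟧ + (⟦ chooseᵇ (suc t) U v ⟧ + 0)) (allSubsets n)
      ≡⟨ ∑ˡ-cong (λ v → cong (⟦ chooseᵇ t U v ⟧ +_) (+-identityʳ _)) (allSubsets n) ⟩
    ∑ˡ (λ v → ⟦ chooseᵇ t U v ⟧ + ⟦ chooseᵇ (suc t) U v ⟧) (allSubsets n)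
      ≡⟨ ∑ˡ-+ (⟦_⟧ ∘ chooseᵇ t U) (⟦_⟧ ∘ chooseᵇ (suc t) U) (allSubsets n) ⟩
    ∑ˡ (⟦_⟧ ∘ chooseᵇ t U) (allSubsets n) + ∑ˡ (⟦_⟧ ∘ chooseᵇ (suc t) U) (allSubsets n)
      ≡⟨ cong₂ _+_ (∑-chooseᵇ t U) (∑-chooseᵇ (suc t) U) ⟩
    (∣ U ∣ C t) + (∣ U ∣ C suc t)
      ≡⟨ nCk+nC[k+1]≡[n+1]C[k+1] ∣ U ∣ t ⟩
    suc ∣ U ∣ C suc t
      ∎
    where open ≡-Reasoning
  byHead outside t = trans (∑ˡ-cong (λ v → cong₂ _+_ (cong ⟦_⟧ (∧-zeroʳ (∣ inside ∷ᵥ v ∣ ≡ᵇ t))) (+-identityʳ _)) (allSubsets n)) (∑-chooseᵇ t U)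

-- Colour classes

≢replicate⇒∃≢ : ∀ {c n} {x : Fin c} (S : Vec (Fin c) n) → S ≢ replicate n x → ∃ λ i → lookup S i ≢ x
≢replicate⇒∃≢ []ᵥ []≢[] = ⊥-elim ([]≢[] refl)
≢replicate⇒∃≢ {x = x} (s ∷ᵥ S) s∷S≢x∷xs with s ≟ x
... | no s≢x = zero , s≢x
... | yes refl = let (i , Si≢x) = ≢replicate⇒∃≢ S (s∷S≢x∷xs ∘ cong (x ∷ᵥ_)) in suc i , Si≢x

colourClass : ∀ {c n} → Vec (Fin c) n → Fin c → Subset n
colourClass S j = tabulate (λ i → ⌊ lookup S i ≟ j ⌋)

module _ {c n : ℕ} (S : Vec (Fin c) n) where

  ∈-colourClass : ∀ {i j} → i ∈ colourClass S j ⇔ lookup S i ≡ j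
  ∈-colourClass {i} {j} = mk⇔
    (λ i∈Sj → toWitness (from T-≡ (trans (sym (lookup∘tabulate _ i)) (to ∈⇔lookup i∈Sj))))
    (λ Si≡j → from ∈⇔lookup (trans (lookup∘tabulate _ i) (to T-≡ (fromWitness Si≡j))))

  colourClass-disjoint : ∀ {j j'} → j ≢ j' → Empty (colourClass S j ∩ colourClass S j')
  colourClass-disjoint j≢j' (i , i∈Sj∩Sj') =
    let (i∈Sj , i∈Sj') = x∈p∩q⁻ (colourClass S _) _ i∈Sj∩Sj'
    in j≢j' (trans (sym (to ∈-colourClass i∈Sj)) (to ∈-colourClass i∈Sj'))

countᵇ-tabulate : ∀ {A : Set} {n} (p : A → Bool) (f : Fin n → A) →
  countᵇ p (Data.List.tabulate f) ≡ ∣ tabulate (p ∘ f) ∣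
countᵇ-tabulate {n = zero} p f = refl
countᵇ-tabulate {n = suc n} p f with p (f zero)
... | true = cong suc (countᵇ-tabulate p (f ∘ suc))
... | false = countᵇ-tabulate p (f ∘ suc)

occ≡∣colourClass∣ : ∀ {c n} (S : Vec (Fin c) n) (j : Fin c) → occ S j ≡ ∣ colourClass S j ∣
occ≡∣colourClass∣ S j = countᵇ-tabulate (λ i → ⌊ lookup S i ≟ j ⌋) id

∑-∣colourClass∣ : ∀ {c n} (S : Vec (Fin c) n) → sum (λ j → ∣ colourClass S j ∣) ≡ n
∑-∣colourClass∣ {c} []ᵥ = sum-zero {c} (λ _ → refl)
∑-∣colourClass∣ {c} (s ∷ᵥ S) = begin
  sum (λ j → ∣ ⌊ s ≟ j ⌋ ∷ᵥ colourClass S j ∣)                       ≡⟨ sum-cong-≗ (λ j → ∣∷∣ ⌊ s ≟ j ⌋ (colourClass S j)) ⟩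
  sum (λ j → ⟦ ⌊ s ≟ j ⌋ ⟧ + ∣ colourClass S j ∣)                    ≡⟨ ∑-distrib-+ (λ j → ⟦ ⌊ s ≟ j ⌋ ⟧) _ ⟩
  sum (λ j → ⟦ ⌊ s ≟ j ⌋ ⟧) + sum (λ j → ∣ colourClass S j ∣)        ≡⟨ cong₂ _+_ one (∑-∣colourClass∣ S) ⟩
  suc _                                                              ∎
  where
  open ≡-Reasoning
  one : sum (λ j → ⟦ ⌊ s ≟ j ⌋ ⟧) ≡ 1
  one = trans (sum-⟦⟧-unique (λ j → ⌊ s ≟ j ⌋) (λ s≡i s≡j → trans (sym (toWitness s≡i)) (toWitness s≡j)))
              (T⇒⟦⟧≡1 (from (T-anyFin {p = λ j → ⌊ s ≟ j ⌋}) (s , fromWitness refl)))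

colourCounts : ∀ {c n} → Vec (Fin c) n → Subset n → Vector ℕ c
colourCounts S U j = ∣ U ∩ colourClass S j ∣

module _ {c n : ℕ} (t : ℕ) (S : Vec (Fin (suc c)) n) (k : Vector ℕ c) (occ≡kt : ∀ j → occ S (suc j) ≡ k j * t) where

  colourCounts-⊤ : colourCounts S ⊤ ≗ occ S zero ∷ᶠ (λ j → k j * t)
  colourCounts-⊤ zero = trans (cong ∣_∣ (∩-identityˡ (colourClass S zero))) (sym (occ≡∣colourClass∣ S zero))
  colourCounts-⊤ (suc j) = trans (cong ∣_∣ (∩-identityˡ (colourClass S (suc j)))) (trans (sym (occ≡∣colourClass∣ S (suc j))) (occ≡kt j))

  occ-zero+Kt≡n : occ S zero + sum k * t ≡ n
  occ-zero+Kt≡n = begin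
    occ S zero + sum k * t                                              ≡⟨ cong (occ S zero +_) (*-distribʳ-sum t k) ⟩
    occ S zero + sum (λ j → k j * t)                                    ≡⟨ cong₂ _+_ (occ≡∣colourClass∣ S zero) (sum-cong-≗ class-size) ⟩
    ∣ colourClass S zero ∣ + sum (λ j → ∣ colourClass S (suc j) ∣)      ≡⟨ ∑-∣colourClass∣ S ⟩
    n                                                                   ∎
    where
    open ≡-Reasoning
    class-size : ∀ j → k j * t ≡ ∣ colourClass S (suc j) ∣
    class-size j = trans (sym (occ≡kt j)) (occ≡∣colourClass∣ S (suc j))

module _ {A : Set} where

  updateAt-cong : ∀ {n} (j : Fin n) {f : A → A} {u v : Vector A n} → u ≗ v → updateAt u j f ≗ updateAt v j f
  updateAt-cong zero {f} u≗v zero = cong f (u≗v zero)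
  updateAt-cong zero u≗v (suc i) = u≗v (suc i)
  updateAt-cong (suc j) u≗v zero = u≗v zero
  updateAt-cong (suc j) u≗v (suc i) = updateAt-cong j (u≗v ∘ suc) i

  map-updateAt : ∀ {B : Set} {n} (j : Fin n) {f : A → A} {g : B → B} (h : A → B) (xs : Vector A n) →
    (∀ x → h (f x) ≡ g (h x)) → h ∘ updateAt xs j f ≗ updateAt (h ∘ xs) j g
  map-updateAt zero h xs h∘f≗g∘h zero = h∘f≗g∘h (xs zero)
  map-updateAt zero h xs h∘f≗g∘h (suc i) = refl
  map-updateAt (suc j) h xs h∘f≗g∘h zero = refl
  map-updateAt (suc j) h xs h∘f≗g∘h (suc i) = map-updateAt j h (xs ∘ suc) h∘f≗g∘h i

-- Hypermatchings and Δ(M)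

module _ {n m : ℕ} where

  Uniform : ℕ → Vec (Subset n) m → Set
  Uniform t M = ∀ a → ∣ lookup M a ∣ ≡ t

  Disjoint : Vec (Subset n) m → Set
  Disjoint M = ∀ a b → a ≢ b → Empty (lookup M a ∩ lookup M b)

  Within : Subset n → Vec (Subset n) m → Set
  Within U M = ∀ a → lookup M a ⊆ U

  module _ {c : ℕ} (S : Vec (Fin (suc c)) n) where

    Constant : Vec (Subset n) m → Set
    Constant M = ∀ a {i i'} → i ∈ lookup M a → i' ∈ lookup M a → lookup S i ≡ lookup S i'

    Monochromatic : Vec (Subset n) m → Set
    Monochromatic M = ∀ a → ∃ λ j → lookup M a ⊆ colourClass S j

    Covers : Subset n → Vec (Subset n) m → Set
    Covers U M = ∀ i → i ∈ U → (∃ λ a → i ∈ lookup M a) ⊎ lookup S i ≡ zero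

    Constant⇔Monochromatic : {M : Vec (Subset n) m} → Constant M ⇔ Monochromatic M
    Constant⇔Monochromatic {M} = mk⇔ toMono toConst
      where
      toMono : Constant M → Monochromatic M
      toMono const a with nonempty? (lookup M a)
      ... | yes (i , i∈Ma) = lookup S i , λ i'∈Ma → from (∈-colourClass S) (const a i'∈Ma i∈Ma)
      ... | no empty = zero , λ i'∈Ma → ⊥-elim (empty (_ , i'∈Ma))
      toConst : Monochromatic M → Constant M
      toConst mono a i∈Ma i'∈Ma = let (j , Ma⊆Sj) = mono a in
        trans (to (∈-colourClass S) (Ma⊆Sj i∈Ma)) (sym (to (∈-colourClass S) (Ma⊆Sj i'∈Ma)))

-- The tests of Defs combine pairs of conditions with a local disjunction that cannot be named
-- here, so it is unfolded by `with` on the decision it is applied to.  For that abstraction to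
-- go through, hypotheses are kept as equations b ≡ true, which unify injectively (T b does not),
-- and the left conjunct of each _∧_ is supplied explicitly.

not-∧≡true : ∀ {x y} → not (x ∧ y) ≡ true → x ≡ true → y ≢ true
not-∧≡true {true} {true} ()

not-∧≡false : ∀ {x y} → not (x ∧ y) ≡ false → x ≡ true × y ≡ true
not-∧≡false {true} {true} _ = refl , refl

isZeroᶠ≡true : ∀ {r} {s : Fin (suc r)} → isZeroᶠ s ≡ true ⇔ s ≡ zero
isZeroᶠ≡true {s = zero} = mk⇔ (λ _ → refl) (λ _ → refl)
isZeroᶠ≡true {s = suc _} = mk⇔ (λ ()) (λ ())

module _ {t n m : ℕ} {M : Vec (Subset n) m} where

  private
    sizesᵇ : Bool
    sizesᵇ = all (λ a → ∣ lookup M a ∣ ≡ᵇ t) (allFin m)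

  isHypermatching⇒Uniform : isHypermatching t n m M ≡ true → Uniform t M
  isHypermatching⇒Uniform h a = ≡ᵇ⇒≡ _ t (from T-≡ (to (all-allFin⇔ {m}) (proj₁ (to (∧≡true⇔ {sizesᵇ}) h)) a))

  isHypermatching⇒Disjoint : isHypermatching t n m M ≡ true → Disjoint M
  isHypermatching⇒Disjoint h a b a≢b (i , i∈Ma∩Mb)
    with to (all-allFin⇔ {m}) (to (all-allFin⇔ {m}) (proj₂ (to (∧≡true⇔ {sizesᵇ}) h)) a) b
  ... | pair-ab with a ≟ b
  ...   | yes a≡b = a≢b a≡b
  ...   | no _ = let (i∈Ma , i∈Mb) = x∈p∩q⁻ (lookup M a) (lookup M b) i∈Ma∩Mb in
                 not-∧≡true (to (all-allFin⇔ {n}) pair-ab i) (to ∈⇔lookup i∈Ma) (to ∈⇔lookup i∈Mb)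

  Uniform∧Disjoint⇒isHypermatching : Uniform t M → Disjoint M → isHypermatching t n m M ≡ true
  Uniform∧Disjoint⇒isHypermatching uniform disjoint with isHypermatching t n m M in eq
  ... | true = refl
  ... | false with ∧≡false {sizesᵇ} eq
  ...   | inj₁ sizes≡false =
    case trans (sym sizes≡false) (from (all-allFin⇔ {m}) λ a → to T-≡ (≡⇒≡ᵇ _ t (uniform a))) of λ ()
  ...   | inj₂ pairs≡false with all-allFin-false {m} pairs≡false
  ...   | a , pairs-a≡false with all-allFin-false {m} pairs-a≡false
  ...   | b , pair-ab≡false with a ≟ b
  ...   | yes _ = case pair-ab≡false of λ ()
  ...   | no a≢b with all-allFin-false {n} pair-ab≡false
  ...   | i , e = let (i∈Ma , i∈Mb) = not-∧≡false e in
                  ⊥-elim (disjoint a b a≢b (i , x∈p∩q⁺ (from ∈⇔lookup i∈Ma , from ∈⇔lookup i∈Mb)))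

  isHypermatching⇔ : isHypermatching t n m M ≡ true ⇔ (Uniform t M × Disjoint M)
  isHypermatching⇔ = mk⇔ (λ h → isHypermatching⇒Uniform h , isHypermatching⇒Disjoint h)
                         (uncurry Uniform∧Disjoint⇒isHypermatching)

module _ {r n m : ℕ} {S : Vec (Fin (suc r)) n} {M : Vec (Subset n) m} where

  private
    nonzeroᵇ : Bool
    nonzeroᵇ = any (λ i → not (isZeroᶠ (lookup S i))) (allFin n)

  inΔ⇒Constant : inΔ S M ≡ true → Constant S M
  inΔ⇒Constant h a {i} {i'} i∈Ma i'∈Ma
    with to (all-allFin⇔ {m}) (proj₁ (to ∧≡true⇔ (proj₂ (to (∧≡true⇔ {nonzeroᵇ}) h)))) a
  ... | const-a with to (all-allFin⇔ {n}) (to (all-allFin⇔ {n}) const-a i) i'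
  ... | const-aii' with lookup (lookup M a) i | to ∈⇔lookup i∈Ma | lookup (lookup M a) i' | to ∈⇔lookup i'∈Ma
  ... | true | refl | true | refl = toWitness (from T-≡ const-aii')

  inΔ⇒Covers : inΔ S M ≡ true → Covers S ⊤ M
  inΔ⇒Covers h i _ with to (all-allFin⇔ {n}) (proj₂ (to (∧≡true⇔ {all _ (allFin m)}) (proj₂ (to (∧≡true⇔ {nonzeroᵇ}) h)))) i
  ... | covered-i with any (λ a → lookup (lookup M a) i) (allFin m) in covered
  ... | true = inj₁ (let (a , i∈Ma) = to any-allFin⇔ covered in a , from ∈⇔lookup i∈Ma)
  ... | false = inj₂ (to isZeroᶠ≡true covered-i)

  Constant∧Covers⇒inΔ : (∃ λ i → lookup S i ≢ zero) → Constant S M → Covers S ⊤ M → inΔ S M ≡ true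
  Constant∧Covers⇒inΔ (i₀ , Si₀≢0) constant covers with inΔ S M in eq
  ... | true = refl
  ... | false with ∧≡false {nonzeroᵇ} eq
  ...   | inj₁ nonzero≡false =
    case trans (sym nonzero≡false) (from (any-allFin⇔ {n}) (i₀ , nonZero Si₀≢0)) of λ ()
    where
    nonZero : ∀ {s : Fin (suc r)} → s ≢ zero → not (isZeroᶠ s) ≡ true
    nonZero {zero} 0≢0 = ⊥-elim (0≢0 refl)
    nonZero {suc _} _ = refl
  ...   | inj₂ rest with ∧≡false {all _ (allFin m)} rest
  ...   | inj₁ const≡false with all-allFin-false {m} const≡false
  ...   | a , const-a with all-allFin-false {n} const-a
  ...   | i , const-ai with all-allFin-false {n} const-ai
  ...   | i' , const-aii' with lookup (lookup M a) i in i∈Ma | lookup (lookup M a) i' in i'∈Ma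
  ...   | true | true = case trans (sym const-aii') (to T-≡ (fromWitness (constant a (from ∈⇔lookup i∈Ma) (from ∈⇔lookup i'∈Ma)))) of λ ()
  ...   | true | false = case const-aii' of λ ()
  ...   | false | _ = case const-aii' of λ ()
  Constant∧Covers⇒inΔ (i₀ , Si₀≢0) constant covers | false | inj₂ rest | inj₂ covers≡false
    with all-allFin-false {n} covers≡false
  ... | i , covers-i with any (λ a → lookup (lookup M a) i) (allFin m) in covered
  ... | true = case covers-i of λ ()
  ... | false with covers i ∈⊤
  ... | inj₁ (a , i∈Ma) = case trans (sym covered) (from any-allFin⇔ (a , to ∈⇔lookup i∈Ma)) of λ ()
  ... | inj₂ Si≡0 = case trans (sym covers-i) (from isZeroᶠ≡true Si≡0) of λ ()

-- Counting edge by edge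

module Packing (t : ℕ) where

  packᵇ : ∀ {n m} → Subset n → Vec (Subset n) m → Bool
  packᵇ U []ᵥ = true
  packᵇ U (x ∷ᵥ M) = chooseᵇ t U x ∧ packᵇ (U ─ x) M

  packᵇ⇔ : ∀ {n m} {U : Subset n} {M : Vec (Subset n) m} → T (packᵇ U M) ⇔ (Uniform t M × Disjoint M × Within U M)
  packᵇ⇔ {M = []ᵥ} = mk⇔ (λ _ → (λ ()) , (λ ()) , (λ ())) (λ _ → _)
  packᵇ⇔ {n} {suc m} {U} {x ∷ᵥ M} = mk⇔ sound complete
    where
    sound : T (packᵇ U (x ∷ᵥ M)) → Uniform t (x ∷ᵥ M) × Disjoint (x ∷ᵥ M) × Within U (x ∷ᵥ M)
    sound h = uniform , disjoint , within
      where
      first : ∣ x ∣ ≡ t × x ⊆ U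
      first = to chooseᵇ⇔ (proj₁ (to (T-∧ {chooseᵇ t U x}) h))
      rest : Uniform t M × Disjoint M × Within (U ─ x) M
      rest = to (packᵇ⇔ {M = M}) (proj₂ (to (T-∧ {chooseᵇ t U x}) h))
      uniform : Uniform t (x ∷ᵥ M)
      uniform zero = proj₁ first
      uniform (suc a) = proj₁ rest a
      avoids : ∀ b {i} → i ∈ x → i ∉ lookup M b
      avoids b i∈x i∈Mb = x∈p─q⇒x∉q U x (proj₂ (proj₂ rest) b i∈Mb) i∈x
      disjoint : Disjoint (x ∷ᵥ M)
      disjoint zero zero 0≢0 = ⊥-elim (0≢0 refl)
      disjoint zero (suc b) _ (i , i∈x∩Mb) = let (i∈x , i∈Mb) = x∈p∩q⁻ x _ i∈x∩Mb in avoids b i∈x i∈Mb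
      disjoint (suc a) zero _ (i , i∈Ma∩x) = let (i∈Ma , i∈x) = x∈p∩q⁻ _ x i∈Ma∩x in avoids a i∈x i∈Ma
      disjoint (suc a) (suc b) sa≢sb = proj₁ (proj₂ rest) a b (sa≢sb ∘ cong suc)
      within : Within U (x ∷ᵥ M)
      within zero = proj₂ first
      within (suc a) = p─q⊆p U x ∘ proj₂ (proj₂ rest) a
    complete : Uniform t (x ∷ᵥ M) × Disjoint (x ∷ᵥ M) × Within U (x ∷ᵥ M) → T (packᵇ U (x ∷ᵥ M))
    complete (uniform , disjoint , within) =
      from T-∧ (from chooseᵇ⇔ (uniform zero , within zero) , from (packᵇ⇔ {M = M}) (uniform ∘ suc , disjoint′ , within′))
      where
      disjoint′ : Disjoint M
      disjoint′ a b a≢b = disjoint (suc a) (suc b) (a≢b ∘ suc-injective)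
      within′ : Within (U ─ x) M
      within′ a i∈Ma = x∈p∧x∉q⇒x∈p─q (within (suc a) i∈Ma) (λ i∈x → disjoint zero (suc a) (λ ()) (_ , x∈p∩q⁺ (i∈x , i∈Ma)))

  module _ {c n : ℕ} (S : Vec (Fin (suc c)) n) where

    colourEdgeᵇ : Subset n → Subset n → Bool
    colourEdgeᵇ U x = any (λ j → chooseᵇ t (U ∩ colourClass S j) x) (allFin (suc c))

    -- Δ(M) read edge by edge: each hyperedge is a t-subset of what is left of U inside a single
    -- colour class, and at the end no vertex of nonzero colour is left.
    colourPackᵇ : ∀ {m} → Subset n → Vec (Subset n) m → Bool
    colourPackᵇ U []ᵥ = all (λ j → ∣ U ∩ colourClass S (suc j) ∣ ≡ᵇ 0) (allFin c)
    colourPackᵇ U (x ∷ᵥ M) = colourEdgeᵇ U x ∧ colourPackᵇ (U ─ x) M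

    colourEdgeᵇ⇔ : {U x : Subset n} → T (colourEdgeᵇ U x) ⇔ (T (chooseᵇ t U x) × ∃ λ j → x ⊆ colourClass S j)
    colourEdgeᵇ⇔ {U} {x} = mk⇔ sound complete
      where
      sound : T (colourEdgeᵇ U x) → T (chooseᵇ t U x) × ∃ λ j → x ⊆ colourClass S j
      sound h = let (j , choose-j) = to T-anyFin h; (size , x⊆U∩Sj) = to chooseᵇ⇔ choose-j; (x⊆U , x⊆Sj) = to ⊆-∩ x⊆U∩Sj
                in from chooseᵇ⇔ (size , x⊆U) , j , x⊆Sj
      complete : T (chooseᵇ t U x) × (∃ λ j → x ⊆ colourClass S j) → T (colourEdgeᵇ U x)
      complete (choose , j , x⊆Sj) = let (size , x⊆U) = to chooseᵇ⇔ choose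
                                     in from T-anyFin (j , from chooseᵇ⇔ (size , from ⊆-∩ (x⊆U , x⊆Sj)))

    colourPackᵇ-[]⇔ : {U : Subset n} → T (colourPackᵇ U []ᵥ) ⇔ Covers S U []ᵥ
    colourPackᵇ-[]⇔ {U} = mk⇔ covers uncovered
      where
      covers : T (colourPackᵇ U []ᵥ) → Covers S U []ᵥ
      covers h i i∈U with lookup S i in Si
      ... | zero = inj₂ refl
      ... | suc j = ⊥-elim (∣p∣≡0⇒Empty (≡ᵇ⇒≡ _ 0 (to (T-allFin {c}) h j)) (i , x∈p∩q⁺ (i∈U , from (∈-colourClass S) Si)))
      uncovered : Covers S U []ᵥ → T (colourPackᵇ U []ᵥ)
      uncovered covers = from (T-allFin {c}) λ j → ≡⇒≡ᵇ _ 0 (Empty⇒∣p∣≡0 λ (i , i∈U∩Sj) →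
        let (i∈U , i∈Sj) = x∈p∩q⁻ U _ i∈U∩Sj in
        case covers i i∈U of λ where
          (inj₁ (() , _))
          (inj₂ Si≡0) → case trans (sym Si≡0) (to (∈-colourClass S) i∈Sj) of λ ())

    colourPackᵇ⇔ : ∀ {m} {U : Subset n} {M : Vec (Subset n) m} →
      T (colourPackᵇ U M) ⇔ (T (packᵇ U M) × Monochromatic S M × Covers S U M)
    colourPackᵇ⇔ {M = []ᵥ} = mk⇔ (λ h → _ , (λ ()) , to colourPackᵇ-[]⇔ h) (λ (_ , _ , covers) → from colourPackᵇ-[]⇔ covers)
    colourPackᵇ⇔ {suc m} {U} {x ∷ᵥ M} = mk⇔ sound complete
      where
      sound : T (colourPackᵇ U (x ∷ᵥ M)) → T (packᵇ U (x ∷ᵥ M)) × Monochromatic S (x ∷ᵥ M) × Covers S U (x ∷ᵥ M)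
      sound h = from T-∧ (proj₁ first , proj₁ rest) , monochromatic , covers
        where
        first : T (chooseᵇ t U x) × ∃ λ j → x ⊆ colourClass S j
        first = to colourEdgeᵇ⇔ (proj₁ (to T-∧ h))
        rest : T (packᵇ (U ─ x) M) × Monochromatic S M × Covers S (U ─ x) M
        rest = to (colourPackᵇ⇔ {M = M}) (proj₂ (to T-∧ h))
        monochromatic : Monochromatic S (x ∷ᵥ M)
        monochromatic zero = proj₂ first
        monochromatic (suc a) = proj₁ (proj₂ rest) a
        covers : Covers S U (x ∷ᵥ M)
        covers i i∈U with i ∈? x
        ... | yes i∈x = inj₁ (zero , i∈x)
        ... | no i∉x with proj₂ (proj₂ rest) i (x∈p∧x∉q⇒x∈p─q i∈U i∉x)
        ...   | inj₁ (a , i∈Ma) = inj₁ (suc a , i∈Ma)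
        ...   | inj₂ Si≡0 = inj₂ Si≡0
      complete : T (packᵇ U (x ∷ᵥ M)) × Monochromatic S (x ∷ᵥ M) × Covers S U (x ∷ᵥ M) → T (colourPackᵇ U (x ∷ᵥ M))
      complete (pack , monochromatic , covers) =
        from T-∧ (from colourEdgeᵇ⇔ (proj₁ (to T-∧ pack) , monochromatic zero) ,
                  from (colourPackᵇ⇔ {M = M}) (proj₂ (to T-∧ pack) , monochromatic ∘ suc , covers′))
        where
        covers′ : Covers S (U ─ x) M
        covers′ i i∈U─x with covers i (p─q⊆p U x i∈U─x)
        ... | inj₁ (zero , i∈x) = ⊥-elim (x∈p─q⇒x∉q U x i∈U─x i∈x)
        ... | inj₁ (suc a , i∈Ma) = inj₁ (a , i∈Ma)
        ... | inj₂ Si≡0 = inj₂ Si≡0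

  isHypermatching≡packᵇ : ∀ {n m} (M : Vec (Subset n) m) → isHypermatching t n m M ≡ packᵇ ⊤ M
  isHypermatching≡packᵇ {n} {m} M = T-⇔⇒≡ (mk⇔ sound complete)
    where
    hypermatching⇔ : isHypermatching t n m M ≡ true ⇔ (Uniform t M × Disjoint M)
    hypermatching⇔ = isHypermatching⇔ {M = M}
    sound : T (isHypermatching t n m M) → T (packᵇ ⊤ M)
    sound h = let (uniform , disjoint) = to hypermatching⇔ (to T-≡ h) in from (packᵇ⇔ {M = M}) (uniform , disjoint , λ _ → ⊆⊤)
    complete : T (packᵇ ⊤ M) → T (isHypermatching t n m M)
    complete h = let (uniform , disjoint , _) = to (packᵇ⇔ {M = M}) h in from T-≡ (from hypermatching⇔ (uniform , disjoint))

  isHypermatching∧inΔ≡colourPackᵇ : ∀ {c n m} (S : Vec (Fin (suc c)) n) (M : Vec (Subset n) m) →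
    (∃ λ i → lookup S i ≢ zero) → isHypermatching t n m M ∧ inΔ S M ≡ colourPackᵇ S ⊤ M
  isHypermatching∧inΔ≡colourPackᵇ {c} {n} {m} S M nonzero = T-⇔⇒≡ (mk⇔ sound complete)
    where
    hypermatching⇔ : isHypermatching t n m M ≡ true ⇔ (Uniform t M × Disjoint M)
    hypermatching⇔ = isHypermatching⇔ {M = M}
    sound : T (isHypermatching t n m M ∧ inΔ S M) → T (colourPackᵇ S ⊤ M)
    sound h = let (hyp , Δ) = to (T-∧ {isHypermatching t n m M}) h
                  (uniform , disjoint) = to hypermatching⇔ (to T-≡ hyp)
                  inΔ≡true = to (T-≡ {inΔ S M}) Δ
              in from (colourPackᵇ⇔ S {M = M}) (from (packᵇ⇔ {M = M}) (uniform , disjoint , λ _ → ⊆⊤) ,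
                                         to (Constant⇔Monochromatic S {M}) (inΔ⇒Constant {S = S} {M} inΔ≡true) ,
                                         inΔ⇒Covers {S = S} {M} inΔ≡true)
    complete : T (colourPackᵇ S ⊤ M) → T (isHypermatching t n m M ∧ inΔ S M)
    complete h = let (pack , monochromatic , covers) = to (colourPackᵇ⇔ S {M = M}) h
                     (uniform , disjoint , _) = to (packᵇ⇔ {M = M}) pack
                 in from T-∧ (from T-≡ (from hypermatching⇔ (uniform , disjoint)) ,
                              from T-≡ (Constant∧Covers⇒inΔ {S = S} {M} nonzero (from (Constant⇔Monochromatic S {M}) monochromatic) covers))

  packings : ℕ → ℕ → ℕ
  packings u zero = 1
  packings u (suc m) = (u C t) * packings (u ∸ t) m

  ∑-packᵇ : ∀ {n} m (U : Subset n) → ∑ˡ (⟦_⟧ ∘ packᵇ U) (allVecs (allSubsets n) m) ≡ packings ∣ U ∣ m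
  ∑-packᵇ zero U = refl
  ∑-packᵇ {n} (suc m) U = begin
    ∑ˡ (⟦_⟧ ∘ packᵇ U) (allVecs xs (suc m))
      ≡⟨ ∑ˡ-allVecs m (⟦_⟧ ∘ packᵇ U) xs ⟩
    ∑ˡ (λ x → ∑ˡ (λ M → ⟦ chooseᵇ t U x ∧ packᵇ (U ─ x) M ⟧) (allVecs xs m)) xs
      ≡⟨ ∑ˡ-cong (λ x → ∑ˡ-⟦∧⟧ (chooseᵇ t U x) (packᵇ (U ─ x)) (allVecs xs m)) xs ⟩
    ∑ˡ (λ x → ⟦ chooseᵇ t U x ⟧ * ∑ˡ (⟦_⟧ ∘ packᵇ (U ─ x)) (allVecs xs m)) xs
      ≡⟨ ∑ˡ-cong (λ x → ⟦⟧*-cong (chooseᵇ t U x) (λ chosen → remaining x (to chooseᵇ⇔ chosen))) xs ⟩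
    ∑ˡ (λ x → ⟦ chooseᵇ t U x ⟧ * packings (∣ U ∣ ∸ t) m) xs
      ≡⟨ ∑ˡ-*ʳ (packings (∣ U ∣ ∸ t) m) (⟦_⟧ ∘ chooseᵇ t U) xs ⟩
    ∑ˡ (⟦_⟧ ∘ chooseᵇ t U) xs * packings (∣ U ∣ ∸ t) m
      ≡⟨ cong (_* packings (∣ U ∣ ∸ t) m) (∑-chooseᵇ t U) ⟩
    (∣ U ∣ C t) * packings (∣ U ∣ ∸ t) m
      ∎
    where
    open ≡-Reasoning
    xs : List (Subset n)
    xs = allSubsets n
    remaining : ∀ x → ∣ x ∣ ≡ t × x ⊆ U → ∑ˡ (⟦_⟧ ∘ packᵇ (U ─ x)) (allVecs xs m) ≡ packings (∣ U ∣ ∸ t) m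
    remaining x (size , x⊆U) = begin
      ∑ˡ (⟦_⟧ ∘ packᵇ (U ─ x)) (allVecs xs m)  ≡⟨ ∑-packᵇ m (U ─ x) ⟩
      packings ∣ U ─ x ∣ m                       ≡⟨ cong (λ u → packings u m) (∣p─q∣≡∣p∣∸∣q∣ U x x⊆U) ⟩
      packings (∣ U ∣ ∸ ∣ x ∣) m                 ≡⟨ cong (λ s → packings (∣ U ∣ ∸ s) m) size ⟩
      packings (∣ U ∣ ∸ t) m                     ∎

  colourPackings : ∀ {c} → ℕ → Vector ℕ (suc c) → ℕ
  colourPackings {c} zero counts = ⟦ all (λ j → counts (suc j) ≡ᵇ 0) (allFin c) ⟧
  colourPackings (suc m) counts = sum λ j → (counts j C t) * colourPackings m (updateAt counts j (_∸ t))

  colourPackings-cong : ∀ {c} m {u v : Vector ℕ (suc c)} → u ≗ v → colourPackings m u ≡ colourPackings m v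
  colourPackings-cong {c} zero u≗v = cong (⟦_⟧ ∘ and) (map-cong (λ j → cong (_≡ᵇ 0) (u≗v (suc j))) (allFin c))
  colourPackings-cong (suc m) u≗v =
    sum-cong-≗ λ j → cong₂ _*_ (cong (_C t) (u≗v j)) (colourPackings-cong m (updateAt-cong j {_∸ t} u≗v))

  colourCounts-─ : ∀ {c n} (S : Vec (Fin (suc c)) n) {U x : Subset n} {j} → ∣ x ∣ ≡ t → x ⊆ U ∩ colourClass S j →
    colourCounts S (U ─ x) ≗ updateAt (colourCounts S U) j (_∸ t)
  colourCounts-─ S {U} {x} {j} size x⊆U∩Sj j′ with to ⊆-∩ x⊆U∩Sj | j′ ≟ j
  ... | x⊆U , x⊆Sj | yes refl = begin
    ∣ (U ─ x) ∩ colourClass S j ∣                ≡⟨ ∣p─q∩r∣≡∣p∩r∣∸∣q∩r∣ U x _ x⊆U ⟩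
    ∣ U ∩ colourClass S j ∣ ∸ ∣ x ∩ colourClass S j ∣  ≡⟨ cong (λ s → ∣ U ∩ colourClass S j ∣ ∸ ∣ s ∣) (p⊆q⇒p∩q≡p x _ x⊆Sj) ⟩
    ∣ U ∩ colourClass S j ∣ ∸ ∣ x ∣              ≡⟨ cong (∣ U ∩ colourClass S j ∣ ∸_) size ⟩
    ∣ U ∩ colourClass S j ∣ ∸ t                  ≡⟨ updateAt-updates j (colourCounts S U) ⟨
    updateAt (colourCounts S U) j (_∸ t) j       ∎
    where open ≡-Reasoning
  ... | x⊆U , x⊆Sj | no j′≢j = begin
    ∣ (U ─ x) ∩ colourClass S j′ ∣                ≡⟨ ∣p─q∩r∣≡∣p∩r∣∸∣q∩r∣ U x _ x⊆U ⟩
    ∣ U ∩ colourClass S j′ ∣ ∸ ∣ x ∩ colourClass S j′ ∣  ≡⟨ cong (∣ U ∩ colourClass S j′ ∣ ∸_) (∣x∩q∣≡0 x⊆Sj (colourClass-disjoint S (j′≢j ∘ sym))) ⟩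
    ∣ U ∩ colourClass S j′ ∣                      ≡⟨ updateAt-minimal j′ j (colourCounts S U) j′≢j ⟨
    updateAt (colourCounts S U) j (_∸ t) j′       ∎
    where open ≡-Reasoning

  module _ (1≤t : 1 ≤ t) {c n : ℕ} (S : Vec (Fin (suc c)) n) where

    chooseᵇ-colourClass-unique : ∀ {U x : Subset n} {j j′} →
      T (chooseᵇ t (U ∩ colourClass S j) x) → T (chooseᵇ t (U ∩ colourClass S j′) x) → j ≡ j′
    chooseᵇ-colourClass-unique {U} {x} {j} {j′} chosen chosen′ =
      let (size , x⊆U∩Sj) = to (chooseᵇ⇔ {U = U ∩ colourClass S j} {x}) chosen
          (_ , x⊆U∩Sj′) = to (chooseᵇ⇔ {U = U ∩ colourClass S j′} {x}) chosen′
          (i , i∈x) = 0<∣p∣⇒Nonempty (≤-trans 1≤t (≤-reflexive (sym size)))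
      in trans (sym (to (∈-colourClass S) (proj₂ (to ⊆-∩ x⊆U∩Sj) i∈x))) (to (∈-colourClass S) (proj₂ (to ⊆-∩ x⊆U∩Sj′) i∈x))

    ⟦colourEdgeᵇ⟧≡sum : ∀ (U x : Subset n) → ⟦ colourEdgeᵇ S U x ⟧ ≡ sum (λ j → ⟦ chooseᵇ t (U ∩ colourClass S j) x ⟧)
    ⟦colourEdgeᵇ⟧≡sum U x = sym (sum-⟦⟧-unique (λ j → chooseᵇ t (U ∩ colourClass S j) x) (chooseᵇ-colourClass-unique {U} {x}))

    ∑-colourPackᵇ : ∀ m (U : Subset n) → ∑ˡ (⟦_⟧ ∘ colourPackᵇ S U) (allVecs (allSubsets n) m) ≡ colourPackings m (colourCounts S U)
    ∑-colourPackᵇ zero U = +-identityʳ _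
    ∑-colourPackᵇ (suc m) U = begin
      ∑ˡ (⟦_⟧ ∘ colourPackᵇ S U) (allVecs xs (suc m))
        ≡⟨ ∑ˡ-allVecs m (⟦_⟧ ∘ colourPackᵇ S U) xs ⟩
      ∑ˡ (λ x → ∑ˡ (λ M → ⟦ colourEdgeᵇ S U x ∧ colourPackᵇ S (U ─ x) M ⟧) (allVecs xs m)) xs
        ≡⟨ ∑ˡ-cong (λ x → ∑ˡ-⟦∧⟧ (colourEdgeᵇ S U x) (colourPackᵇ S (U ─ x)) (allVecs xs m)) xs ⟩
      ∑ˡ (λ x → ⟦ colourEdgeᵇ S U x ⟧ * ∑ˡ (⟦_⟧ ∘ colourPackᵇ S (U ─ x)) (allVecs xs m)) xs
        ≡⟨ ∑ˡ-cong (λ x → cong (⟦ colourEdgeᵇ S U x ⟧ *_) (∑-colourPackᵇ m (U ─ x))) xs ⟩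
      ∑ˡ (λ x → ⟦ colourEdgeᵇ S U x ⟧ * colourPackings m (colourCounts S (U ─ x))) xs
        ≡⟨ ∑ˡ-cong byColour xs ⟩
      ∑ˡ (λ x → sum λ j → ⟦ chooseᵇ t (U ∩ colourClass S j) x ⟧ * colourPackings m (removed j)) xs
        ≡⟨ ∑ˡ-sum-comm (λ x j → ⟦ chooseᵇ t (U ∩ colourClass S j) x ⟧ * colourPackings m (removed j)) xs ⟩
      (sum λ j → ∑ˡ (λ x → ⟦ chooseᵇ t (U ∩ colourClass S j) x ⟧ * colourPackings m (removed j)) xs)
        ≡⟨ sum-cong-≗ (λ j → trans (∑ˡ-*ʳ _ (⟦_⟧ ∘ chooseᵇ t (U ∩ colourClass S j)) xs)
                                   (cong (_* colourPackings m (removed j)) (∑-chooseᵇ t (U ∩ colourClass S j)))) ⟩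
      (sum λ j → (colourCounts S U j C t) * colourPackings m (removed j))
        ∎
      where
      open ≡-Reasoning
      xs : List (Subset n)
      xs = allSubsets n
      removed : Fin (suc c) → Vector ℕ (suc c)
      removed j = updateAt (colourCounts S U) j (_∸ t)
      byColour : ∀ x → ⟦ colourEdgeᵇ S U x ⟧ * colourPackings m (colourCounts S (U ─ x))
                     ≡ sum λ j → ⟦ chooseᵇ t (U ∩ colourClass S j) x ⟧ * colourPackings m (removed j)
      byColour x = begin
        ⟦ colourEdgeᵇ S U x ⟧ * colourPackings m (colourCounts S (U ─ x))
          ≡⟨ cong (_* colourPackings m (colourCounts S (U ─ x))) (⟦colourEdgeᵇ⟧≡sum U x) ⟩
        (sum λ j → ⟦ chooseᵇ t (U ∩ colourClass S j) x ⟧) * colourPackings m (colourCounts S (U ─ x))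
          ≡⟨ *-distribʳ-sum (colourPackings m (colourCounts S (U ─ x))) (λ j → ⟦ chooseᵇ t (U ∩ colourClass S j) x ⟧) ⟩
        (sum λ j → ⟦ chooseᵇ t (U ∩ colourClass S j) x ⟧ * colourPackings m (colourCounts S (U ─ x)))
          ≡⟨ sum-cong-≗ (λ j → ⟦⟧*-cong (chooseᵇ t (U ∩ colourClass S j) x) λ chosen →
               let (size , x⊆U∩Sj) = to (chooseᵇ⇔ {U = U ∩ colourClass S j} {x}) chosen
               in colourPackings-cong m (colourCounts-─ S size x⊆U∩Sj)) ⟩
        (sum λ j → ⟦ chooseᵇ t (U ∩ colourClass S j) x ⟧ * colourPackings m (removed j))
          ∎

-- Closed forms

module ClosedForm (t : ℕ) where
  open Packing t

  packings-! : ∀ p u → p * t ≤ u → packings u p * (t !) ^ p * (u ∸ p * t) ! ≡ u !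
  packings-! zero u _ = +-identityʳ (u !)
  packings-! (suc p) u pt+t≤u = begin
    (u C t) * packings (u ∸ t) p * (t ! * (t !) ^ p) * (u ∸ (t + p * t)) !
      ≡⟨ cong (λ v → (u C t) * packings (u ∸ t) p * (t ! * (t !) ^ p) * v !) (sym (∸-+-assoc u t (p * t))) ⟩
    (u C t) * packings (u ∸ t) p * (t ! * (t !) ^ p) * (u ∸ t ∸ p * t) !
      ≡⟨ regroup (u C t) (packings (u ∸ t) p) (t !) ((t !) ^ p) ((u ∸ t ∸ p * t) !) ⟩
    (u C t) * t ! * (packings (u ∸ t) p * (t !) ^ p * (u ∸ t ∸ p * t) !)
      ≡⟨ cong ((u C t) * t ! *_) (packings-! p (u ∸ t) pt≤u∸t) ⟩
    (u C t) * t ! * (u ∸ t) !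
      ≡⟨ nCk*k!*[n∸k]!≡n! (≤-trans (m≤m+n t (p * t)) pt+t≤u) ⟩
    u !
      ∎
    where
    open ≡-Reasoning
    regroup : ∀ a b c d e → a * b * (c * d) * e ≡ a * c * (b * d * e)
    regroup = solve-∀
    pt≤u∸t : p * t ≤ u ∸ t
    pt≤u∸t = subst (_≤ u ∸ t) (m+n∸m≡n t (p * t)) (∸-monoˡ-≤ t pt+t≤u)

  packings-exact-! : ∀ p → packings (p * t) p * (t !) ^ p ≡ (p * t) !
  packings-exact-! p = begin
    packings (p * t) p * (t !) ^ p                      ≡⟨ *-identityʳ _ ⟨
    packings (p * t) p * (t !) ^ p * 1                  ≡⟨ cong (λ v → packings (p * t) p * (t !) ^ p * v !) (n∸n≡0 (p * t)) ⟨
    packings (p * t) p * (t !) ^ p * (p * t ∸ p * t) !  ≡⟨ packings-! p (p * t) ≤-refl ⟩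
    (p * t) !                                           ∎
    where open ≡-Reasoning

  product-packings-! : ∀ {c} (k : Vector ℕ c) → product (λ j → packings (k j * t) (k j)) * (t !) ^ sum k ≡ product (λ j → (k j * t) !)
  product-packings-! {zero} k = refl
  product-packings-! {suc c} k = begin
    packings (k zero * t) (k zero) * Pₜ * (t !) ^ (k zero + sum (k ∘ suc))
      ≡⟨ cong (packings (k zero * t) (k zero) * Pₜ *_) (^-distribˡ-+-* (t !) (k zero) (sum (k ∘ suc))) ⟩
    packings (k zero * t) (k zero) * Pₜ * ((t !) ^ k zero * (t !) ^ sum (k ∘ suc))
      ≡⟨ regroup (packings (k zero * t) (k zero)) Pₜ ((t !) ^ k zero) ((t !) ^ sum (k ∘ suc)) ⟩
    packings (k zero * t) (k zero) * (t !) ^ k zero * (Pₜ * (t !) ^ sum (k ∘ suc))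
      ≡⟨ cong₂ _*_ (packings-exact-! (k zero)) (product-packings-! (k ∘ suc)) ⟩
    (k zero * t) ! * product (λ j → (k (suc j) * t) !)
      ∎
    where
    open ≡-Reasoning
    Pₜ : ℕ
    Pₜ = product (λ j → packings (k (suc j) * t) (k (suc j)))
    regroup : ∀ a b c d → a * b * (c * d) ≡ a * c * (b * d)
    regroup = solve-∀

  -- Both sides, multiplied by (t!)^m · (n ∸ mt)!, equal n! · Q.
  hypermatching-factorials : ∀ {n m z K Pₖ Q : ℕ} → K ≤ m → z + K * t ≡ n → m * t ≤ n → Pₖ * (t !) ^ K ≡ Q →
    (n C (K * t)) * (K * t) ! * (Pₖ * packings z (m ∸ K)) ≡ packings n m * Q
  hypermatching-factorials {n} {m} {z} {K} {Pₖ} {Q} K≤m z+Kt≡n mt≤n Pₖ-! =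
    *-cancelʳ-≡ _ _ ((t !) ^ m * (n ∸ m * t) !) (trans lhs (sym rhs))
    where
    open ≡-Reasoning
    instance
      _ = m*n≢0 ((t !) ^ m) ((n ∸ m * t) !) {{m^n≢0 (t !) m {{t !≢0}}}} {{(n ∸ m * t) !≢0}}
    [m∸K]t+Kt≡mt : (m ∸ K) * t + K * t ≡ m * t
    [m∸K]t+Kt≡mt = trans (sym (*-distribʳ-+ t (m ∸ K) K)) (cong (_* t) (m∸n+n≡m K≤m))
    [m∸K]t≤z : (m ∸ K) * t ≤ z
    [m∸K]t≤z = +-cancelʳ-≤ (K * t) _ _ (subst₂ _≤_ (sym [m∸K]t+Kt≡mt) (sym z+Kt≡n) mt≤n)
    z∸[m∸K]t≡n∸mt : z ∸ (m ∸ K) * t ≡ n ∸ m * t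
    z∸[m∸K]t≡n∸mt = begin
      z ∸ (m ∸ K) * t                        ≡⟨ [m+n]∸[m+o]≡n∸o (K * t) z ((m ∸ K) * t) ⟨
      K * t + z ∸ (K * t + (m ∸ K) * t)      ≡⟨ cong₂ _∸_ (trans (+-comm (K * t) z) z+Kt≡n) (trans (+-comm (K * t) _) [m∸K]t+Kt≡mt) ⟩
      n ∸ m * t                              ∎
    n∸Kt≡z : n ∸ K * t ≡ z
    n∸Kt≡z = trans (cong (_∸ K * t) (sym z+Kt≡n)) (m+n∸n≡m z (K * t))
    lhs : (n C (K * t)) * (K * t) ! * (Pₖ * packings z (m ∸ K)) * ((t !) ^ m * (n ∸ m * t) !) ≡ n ! * Q
    lhs = begin
      (n C (K * t)) * (K * t) ! * (Pₖ * packings z (m ∸ K)) * ((t !) ^ m * (n ∸ m * t) !)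
        ≡⟨ cong (λ e → (n C (K * t)) * (K * t) ! * (Pₖ * packings z (m ∸ K)) * (e * (n ∸ m * t) !))
                (trans (cong ((t !) ^_) (sym (m+[n∸m]≡n K≤m))) (^-distribˡ-+-* (t !) K (m ∸ K))) ⟩
      (n C (K * t)) * (K * t) ! * (Pₖ * packings z (m ∸ K)) * ((t !) ^ K * (t !) ^ (m ∸ K) * (n ∸ m * t) !)
        ≡⟨ regroup (n C (K * t)) ((K * t) !) Pₖ (packings z (m ∸ K)) ((t !) ^ K) ((t !) ^ (m ∸ K)) ((n ∸ m * t) !) ⟩
      (n C (K * t)) * (K * t) ! * (packings z (m ∸ K) * (t !) ^ (m ∸ K) * (n ∸ m * t) !) * (Pₖ * (t !) ^ K)
        ≡⟨ cong₂ (λ e q → (n C (K * t)) * (K * t) ! * e * q)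
                 (trans (cong (λ u → packings z (m ∸ K) * (t !) ^ (m ∸ K) * u !) (sym z∸[m∸K]t≡n∸mt))
                        (packings-! (m ∸ K) z [m∸K]t≤z))
                 Pₖ-! ⟩
      (n C (K * t)) * (K * t) ! * z ! * Q
        ≡⟨ cong (λ u → (n C (K * t)) * (K * t) ! * u ! * Q) n∸Kt≡z ⟨
      (n C (K * t)) * (K * t) ! * (n ∸ K * t) ! * Q
        ≡⟨ cong (_* Q) (nCk*k!*[n∸k]!≡n! (subst (K * t ≤_) z+Kt≡n (m≤n+m (K * t) z))) ⟩
      n ! * Q
        ∎
      where
      regroup : ∀ c f p h a b e → c * f * (p * h) * (a * b * e) ≡ c * f * (h * b * e) * (p * a)
      regroup = solve-∀
    rhs : packings n m * Q * ((t !) ^ m * (n ∸ m * t) !) ≡ n ! * Q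
    rhs = begin
      packings n m * Q * ((t !) ^ m * (n ∸ m * t) !)   ≡⟨ regroup (packings n m) Q ((t !) ^ m) ((n ∸ m * t) !) ⟩
      packings n m * (t !) ^ m * (n ∸ m * t) ! * Q     ≡⟨ cong (_* Q) (packings-! m n mt≤n) ⟩
      n ! * Q                                          ∎
      where
      regroup : ∀ p q a b → p * q * (a * b) ≡ p * a * b * q
      regroup = solve-∀

  module _ (1≤t : 1 ≤ t) {c : ℕ} where

    private
      _·t : Vector ℕ c → Vector ℕ c
      (k ·t) j = k j * t

      removeOne : Vector ℕ c → Fin c → Vector ℕ c
      removeOne k j = updateAt k j (_∸ 1)

      D P Q : Vector ℕ c → ℕ
      D k = product (λ j → k j !)
      P k = product (λ j → packings (k j * t) (k j))
      Q k = product (λ j → (k j * t) !)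

    colourPackings-suc : ∀ m z (k : Vector ℕ c) → colourPackings (suc m) (z ∷ᶠ k ·t) ≡
      (z C t) * colourPackings m ((z ∸ t) ∷ᶠ k ·t) + sum (λ j → ((k j * t) C t) * colourPackings m (z ∷ᶠ removeOne k j ·t))
    colourPackings-suc m z k = cong₂ _+_
      (cong ((z C t) *_) (colourPackings-cong m λ where zero → refl; (suc i) → refl))
      (sum-cong-≗ λ j → cong (((k j * t) C t) *_) (colourPackings-cong m λ where
        zero → refl
        (suc i) → sym (map-updateAt j (_* t) k (λ x → trans (*-distribʳ-∸ t x 1) (cong (x * t ∸_) (*-identityˡ t))) i)))

    module _ (k : Vector ℕ c) (j : Fin c) {a : ℕ} (kj≡1+a : k j ≡ suc a) where

      private
        removeOne-at : removeOne k j j ≡ a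
        removeOne-at = trans (updateAt-updates j k) (cong (_∸ 1) kj≡1+a)

        removeOne-off : ∀ i → i ≢ j → k i ≡ removeOne k j i
        removeOne-off i i≢j = sym (updateAt-minimal i j k i≢j)

      sum-removeOne : sum k ≡ suc (sum (removeOne k j))
      sum-removeOne = sum-except +-0-commutativeMonoid j {1} (trans kj≡1+a (cong suc (sym removeOne-at))) removeOne-off

      D-removeOne : D k ≡ suc a * D (removeOne k j)
      D-removeOne = sum-except *-1-commutativeMonoid j {suc a}
        (trans (cong _! kj≡1+a) (cong (λ b → suc a * b !) (sym removeOne-at))) (λ i i≢j → cong _! (removeOne-off i i≢j))

      P-removeOne : P k ≡ ((suc a * t) C t) * P (removeOne k j)
      P-removeOne = sum-except *-1-commutativeMonoid j {(suc a * t) C t}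
        (trans (cong (λ b → packings (b * t) b) kj≡1+a)
          (trans (cong (λ u → ((suc a * t) C t) * packings u a) (m+n∸m≡n t (a * t)))
                 (cong (λ b → ((suc a * t) C t) * packings (b * t) b) (sym removeOne-at))))
        (λ i i≢j → cong (λ b → packings (b * t) b) (removeOne-off i i≢j))

    Closed : ℕ → Set
    Closed m = ∀ z (k : Vector ℕ c) →
      colourPackings m (z ∷ᶠ k ·t) * D k ≡ (m C sum k) * sum k ! * (P k * packings z (m ∸ sum k))

    closed-zero : Closed 0
    closed-zero z k with all (λ j → k j * t ≡ᵇ 0) (allFin c) in none
    ... | true = begin
      1 * D k                                                       ≡⟨ cong (1 *_) D≡1 ⟩
      1                                                             ≡⟨ cong (λ K → (0 C K) * K ! * (1 * packings z (0 ∸ K))) K≡0 ⟨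
      (0 C sum k) * sum k ! * (1 * packings z (0 ∸ sum k))          ≡⟨ cong (λ p → (0 C sum k) * sum k ! * (p * packings z (0 ∸ sum k))) P≡1 ⟨
      (0 C sum k) * sum k ! * (P k * packings z (0 ∸ sum k))        ∎
      where
      open ≡-Reasoning
      instance _ = >-nonZero 1≤t
      k≡0 : ∀ j → k j ≡ 0
      k≡0 j = m*n≡0⇒m≡0 (k j) t (≡ᵇ⇒≡ _ 0 (from T-≡ (to all-allFin⇔ none j)))
      K≡0 : sum k ≡ 0
      K≡0 = sum-zero k≡0
      D≡1 : D k ≡ 1
      D≡1 = product-one (λ j → cong _! (k≡0 j))
      P≡1 : P k ≡ 1
      P≡1 = product-one (λ j → cong (λ b → packings (b * t) b) (k≡0 j))
    ... | false = sym (cong (λ C → C * sum k ! * (P k * packings z (0 ∸ sum k))) (k>n⇒nCk≡0 0<K))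
      where
      0<K : 0 < sum k
      0<K with all-allFin-false none
      ... | j , kjt≢0 = <-≤-trans (n≢0⇒n>0 (λ kj≡0 → case trans (sym kjt≢0) (cong (λ b → b * t ≡ᵇ 0) kj≡0) of λ ())) (≤-sum k j)

    module Step {m : ℕ} (closed-m : Closed m) (z : ℕ) (k : Vector ℕ c) where

      K Y R : ℕ
      K = sum k
      Y = P k * packings z (suc m ∸ K)
      R = (m C (K ∸ 1)) * ((K ∸ 1) ! * Y)

      edge-in-class-zero : (z C t) * (colourPackings m ((z ∸ t) ∷ᶠ k ·t) * D k) ≡ (m C K) * (K ! * Y)
      edge-in-class-zero = begin
        (z C t) * (colourPackings m ((z ∸ t) ∷ᶠ k ·t) * D k)
          ≡⟨ cong ((z C t) *_) (closed-m (z ∸ t) k) ⟩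
        (z C t) * ((m C K) * K ! * (P k * packings (z ∸ t) (m ∸ K)))
          ≡⟨ shuffle (z C t) (m C K) (K !) (P k) (packings (z ∸ t) (m ∸ K)) ⟩
        (m C K) * (K ! * (P k * ((z C t) * packings (z ∸ t) (m ∸ K))))
          ≡⟨ nCk*-cong {m} {K} (λ K≤m → cong (λ u → K ! * (P k * packings z u)) (sym (+-∸-assoc 1 K≤m))) ⟩
        (m C K) * (K ! * Y)
          ∎
        where
        open ≡-Reasoning
        shuffle : ∀ a b c d e → a * (b * c * (d * e)) ≡ b * (c * (d * (a * e)))
        shuffle = solve-∀

      edge-in-class-suc : ∀ j → ((k j * t) C t) * colourPackings m (z ∷ᶠ removeOne k j ·t) * D k ≡ k j * R
      edge-in-class-suc j with k j in kj
      ... | zero rewrite k>n⇒nCk≡0 {0} {t} 1≤t = refl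
      ... | suc a rewrite sum-removeOne k j kj | D-removeOne k j kj | P-removeOne k j kj = begin
        ((suc a * t) C t) * colourPackings m (z ∷ᶠ k⁻ ·t) * (suc a * D k⁻)
          ≡⟨ shuffle ((suc a * t) C t) (colourPackings m (z ∷ᶠ k⁻ ·t)) (suc a) (D k⁻) ⟩
        suc a * (((suc a * t) C t) * (colourPackings m (z ∷ᶠ k⁻ ·t) * D k⁻))
          ≡⟨ cong (λ v → suc a * (((suc a * t) C t) * v)) (closed-m z k⁻) ⟩
        suc a * (((suc a * t) C t) * ((m C sum k⁻) * sum k⁻ ! * (P k⁻ * packings z (m ∸ sum k⁻))))
          ≡⟨ cong (suc a *_) (shuffle′ ((suc a * t) C t) (m C sum k⁻) (sum k⁻ !) (P k⁻) (packings z (m ∸ sum k⁻))) ⟩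
        suc a * ((m C sum k⁻) * (sum k⁻ ! * (((suc a * t) C t) * P k⁻ * packings z (m ∸ sum k⁻))))
          ∎
        where
        open ≡-Reasoning
        k⁻ : Vector ℕ c
        k⁻ = removeOne k j
        shuffle : ∀ c f a d → c * f * (a * d) ≡ a * (c * (f * d))
        shuffle = solve-∀
        shuffle′ : ∀ c b f p h → c * (b * f * (p * h)) ≡ b * (f * (c * p * h))
        shuffle′ = solve-∀

    closed-suc : ∀ {m} → Closed m → Closed (suc m)
    closed-suc {m} closed-m z k = begin
      colourPackings (suc m) (z ∷ᶠ k ·t) * D k
        ≡⟨ cong (_* D k) (colourPackings-suc m z k) ⟩
      ((z C t) * F₀ + sum term) * D k
        ≡⟨ *-distribʳ-+ (D k) ((z C t) * F₀) (sum term) ⟩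
      (z C t) * F₀ * D k + sum term * D k
        ≡⟨ cong₂ _+_ (*-assoc (z C t) F₀ (D k)) (*-distribʳ-sum (D k) term) ⟩
      (z C t) * (F₀ * D k) + sum (λ j → term j * D k)
        ≡⟨ cong₂ _+_ edge-in-class-zero (sum-cong-≗ edge-in-class-suc) ⟩
      (m C K) * (K ! * Y) + sum (λ j → k j * R)
        ≡⟨ cong ((m C K) * (K ! * Y) +_) (*-distribʳ-sum R k) ⟨
      (m C K) * (K ! * Y) + K * R
        ≡⟨ regroup (m C K) (K !) K (m C (K ∸ 1)) ((K ∸ 1) !) Y ⟩
      ((m C K) * K ! + K * ((m C (K ∸ 1)) * (K ∸ 1) !)) * Y
        ≡⟨ cong (_* Y) (mCk*k!+k*mC[k∸1]*[k∸1]!≡[1+m]Ck*k! m K) ⟩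
      (suc m C K) * K ! * Y
        ∎
      where
      open ≡-Reasoning
      open Step closed-m z k
      F₀ : ℕ
      F₀ = colourPackings m ((z ∸ t) ∷ᶠ k ·t)
      term : Fin c → ℕ
      term j = ((k j * t) C t) * colourPackings m (z ∷ᶠ removeOne k j ·t)
      regroup : ∀ a b c d e y → a * (b * y) + c * (d * (e * y)) ≡ (a * b + c * (d * e)) * y
      regroup = solve-∀

    colourPackings-closed : ∀ m → Closed m
    colourPackings-closed zero = closed-zero
    colourPackings-closed (suc m) = closed-suc (colourPackings-closed m)

    colourPackings-identity : ∀ {n} m z (k : Vector ℕ c) → z + sum k * t ≡ n → m * t ≤ n →
      colourPackings m (z ∷ᶠ k ·t) * (n C (sum k * t)) * (sum k * t) ! * D k ≡ packings n m * (m C sum k) * sum k ! * Q k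
    colourPackings-identity {n} m z k z+Kt≡n mt≤n = begin
      colourPackings m (z ∷ᶠ k ·t) * (n C (K * t)) * (K * t) ! * D k
        ≡⟨ regroup (colourPackings m (z ∷ᶠ k ·t)) (n C (K * t)) ((K * t) !) (D k) ⟩
      (n C (K * t)) * (K * t) ! * (colourPackings m (z ∷ᶠ k ·t) * D k)
        ≡⟨ cong ((n C (K * t)) * (K * t) ! *_) (colourPackings-closed m z k) ⟩
      (n C (K * t)) * (K * t) ! * ((m C K) * K ! * (P k * packings z (m ∸ K)))
        ≡⟨ regroup′ (n C (K * t)) ((K * t) !) (m C K) (K !) (P k * packings z (m ∸ K)) ⟩
      (m C K) * ((n C (K * t)) * (K * t) ! * (P k * packings z (m ∸ K))) * K !
        ≡⟨ cong (_* K !) (nCk*-cong {m} {K} λ K≤m → hypermatching-factorials {Pₖ = P k} K≤m z+Kt≡n mt≤n (product-packings-! k)) ⟩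
      (m C K) * (packings n m * Q k) * K !
        ≡⟨ regroup″ (m C K) (packings n m) (Q k) (K !) ⟩
      packings n m * (m C K) * K ! * Q k
        ∎
      where
      open ≡-Reasoning
      K : ℕ
      K = sum k
      regroup : ∀ f c e d → f * c * e * d ≡ c * e * (f * d)
      regroup = solve-∀
      regroup′ : ∀ c e b f y → c * e * (b * f * y) ≡ b * (c * e * y) * f
      regroup′ = solve-∀
      regroup″ : ∀ b p q f → b * (p * q) * f ≡ p * b * f * q
      regroup″ = solve-∀

module _ (t : ℕ) where
  open Packing t

  length-hypermatchings : ∀ n m → Data.List.length (hypermatchings t n m) ≡ packings n m
  length-hypermatchings n m = begin
    countᵇ (isHypermatching t n m) Ms                  ≡⟨ countᵇ≡∑ˡ (isHypermatching t n m) Ms ⟩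
    ∑ˡ (⟦_⟧ ∘ isHypermatching t n m) Ms               ≡⟨ ∑ˡ-cong (cong ⟦_⟧ ∘ isHypermatching≡packᵇ) Ms ⟩
    ∑ˡ (⟦_⟧ ∘ packᵇ ⊤) Ms                              ≡⟨ ∑-packᵇ m ⊤ ⟩
    packings ∣ ⊤ {n} ∣ m                               ≡⟨ cong (λ u → packings u m) (∣⊤∣≡n n) ⟩
    packings n m                                       ∎
    where
    open ≡-Reasoning
    Ms : List (Vec (Subset n) m)
    Ms = allVecs (allSubsets n) m

  count-inΔ : ∀ {c n} m → 1 ≤ t → (S : Vec (Fin (suc c)) n) → (∃ λ i → lookup S i ≢ zero) →
    countᵇ (inΔ S) (hypermatchings t n m) ≡ colourPackings m (colourCounts S ⊤)
  count-inΔ {n = n} m 1≤t S nonzero = begin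
    countᵇ (inΔ S) (hypermatchings t n m)                  ≡⟨ countᵇ-filterᵇ (isHypermatching t n m) (inΔ S) Ms ⟩
    countᵇ (λ M → isHypermatching t n m M ∧ inΔ S M) Ms    ≡⟨ countᵇ≡∑ˡ (λ M → isHypermatching t n m M ∧ inΔ S M) Ms ⟩
    ∑ˡ (λ M → ⟦ isHypermatching t n m M ∧ inΔ S M ⟧) Ms   ≡⟨ ∑ˡ-cong (λ M → cong ⟦_⟧ (isHypermatching∧inΔ≡colourPackᵇ S M nonzero)) Ms ⟩
    ∑ˡ (⟦_⟧ ∘ colourPackᵇ S ⊤) Ms                          ≡⟨ ∑-colourPackᵇ 1≤t S m ⊤ ⟩
    colourPackings m (colourCounts S ⊤)                    ∎
    where
    open ≡-Reasoning
    Ms : List (Vec (Subset n) m)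
    Ms = allVecs (allSubsets n) m

lemma4p7 : (r' t n m : ℕ) → 1 ≤ t → t ∣ n → 1 ≤ m → m * t ≤ n →
    (S : Vec (Fin (suc (suc r'))) n) → S ≢ replicate n zero →
    (k : Fin (suc (suc r')) → ℕ) →
    ((j : Fin (suc (suc r'))) → toℕ j ≢ 0 → occ S j ≡ k j * t) →
    countᵇ (inΔ S) (hypermatchings t n m) * (n C (sumNZ k * t)) * ((sumNZ k * t) !) * prodNZ (λ j → k j !)
      ≡ Data.List.length (hypermatchings t n m) * (m C sumNZ k) * (sumNZ k !) * prodNZ (λ j → (k j * t) !)
lemma4p7 r' t n m 1≤t _ _ mt≤n S S≢0 k occ≡kt
  rewrite sumNZ≡sum k | prodNZ≡product (λ j → k j !) | prodNZ≡product (λ j → (k j * t) !)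
        | count-inΔ t m 1≤t S (≢replicate⇒∃≢ S S≢0) | length-hypermatchings t n m
        | Packing.colourPackings-cong t m (colourCounts-⊤ t S (k ∘ suc) (λ j → occ≡kt (suc j) λ ()))
  = ClosedForm.colourPackings-identity t 1≤t m (occ S zero) (k ∘ suc) (occ-zero+Kt≡n t S (k ∘ suc) (λ j → occ≡kt (suc j) λ ())) mt≤n
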